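{- Let $\tilde N=(\tilde V,\tilde E,\mathrm{wt})$ be a cylindrical network with shift vector $\tilde g$ and projection $N$, and let $\tilde u,\tilde v\in\tilde V$ be any two vertices. For $\ell\ge 0$ put $\tilde v_\ell=\tilde v+\ell\tilde g$ and define $f:\mathbb N\to K$ by $f(\ell)=\tilde N(\tilde u,\tilde v_\ell)$. Then $f$ satisfies a linear recurrence with characteristic polynomial $Q_N(t)$ (i.e. the recurrence holds for all but finitely many $\ell$).
   Context: Let $K$ be a field of characteristic zero. Fix reals $A<B$, the strip $\mathcal S=\{(x,y)\in\mathbb R^2: A\le y\le B\}$ and a vector $\tilde g=(m,0)$ with $m>0$. A cylindrical network is a triple $\tilde N=(\tilde V,\tilde E,\mathrm{wt})$ such that: (1) $\tilde V$ is a discrete subset of $\mathcal S$ with $\tilde V+\tilde g=\tilde V$; (2) $\tilde E\subset\tilde V\times\tilde V$ is a set of ordered pairs (directed edges) such that $(\tilde u,\tilde v)\in\tilde E$ implies $(\tilde u+\tilde g,\tilde v+\tilde g)\in\tilde E$; (3) $\mathrm{wt}:\tilde E\to K$ satisfies $\mathrm{wt}(\tilde e+\tilde g)=\mathrm{wt}(\tilde e)$; (4) every vertex has finitely many incoming and finitely many outgoing edges; (5) if for some $\ell\in\mathbb Z$ there is a directed path in $\tilde N$ from $\tilde v$ to $\tilde v+\ell\tilde g$, then $\ell>0$ (so $\tilde N$ is acyclic). The projection $N$ is the finite weighted directed graph with vertex set $V=\tilde V/\mathbb Z\tilde g$, edge set $E=\tilde E/\mathbb Z\tilde g$ (the class of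 $(\tilde u,\tilde v)$ is an edge from the class of $\tilde u$ to the class of $\tilde v$), with inherited weights. A simple cycle $C$ of $N$ is a directed cycle visiting each vertex at most once; $\mathrm{wt}(C)$ is the product of its edge weights, and its winding number $\mathrm{wind}(C)$ is the integer $\ell$ such that any lift of $C$ to a path in $\tilde N$ goes from some $\tilde w$ to $\tilde w+\ell\tilde g$ (so $\mathrm{wind}(C)\ge1$). An $r$-cycle $\mathbf C$ is a collection of $r$ pairwise vertex-disjoint simple cycles $C_1,\dots,C_r$ of $N$ (each collection counted once); $\mathrm{wt}(\mathbf C)=\prod_i\mathrm{wt}(C_i)$, $\mathrm{wind}(\mathbf C)=\sum_i\mathrm{wind}(C_i)$; $\mathcal C^r(N)$ is the set of $r$-cycles ($\mathcal C^0(N)$ consists of the empty collection, with weight $1$ and winding number $0$). Let $d$ be the maximal winding number of an $r$-cycle over all $r\ge0$, and $Q_N(t)=\sum_{r\ge 0}(-1)^{d-r}\sum_{\mathbf C\in\mathcal C^r(N)}t^{d-\mathrm{wind}(\mathbf C)}\mathrm{wt}(\mathbf C)\in K[t]$, a monic polynomial of degree $d$. For $\tilde u,\tilde v\in\tilde V$, $\tilde N(\tilde u,\tilde v)$ is the (finite) sum over all directed paths from $\tilde u$ to $\tilde v$ in $\tilde N$ of the product of the weights of their edges (the trivial path, if $\tilde u=\tilde v$, has weight $1$). A sequence $f:\mathbb N\to K$ satisfies a linear recurrence with characteristic polynomial $Q(t)=t^D-\alpha_1t^{D-1}+\dots+(-1)^D\alpha_D\in K[t]$ if $f(n+D)-\alpha_1f(n+D-1)+\dots+(-1)^D\alpha_Df(n)=0$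 for all but finitely many $n\in\mathbb N$. -}

module Defs where

open import Level using (Level; _⊔_)
open import Algebra.Bundles using (CommutativeRing)
open import Data.Bool using (Bool; true; false; if_then_else_; _∧_; T)
open import Data.Nat as ℕ using (ℕ; zero; suc; _≤_; _<_)
open import Data.Integer as ℤ using (ℤ; +_)
open import Data.Fin as Fin using (Fin; toℕ)
open import Data.Fin.Properties using (_≟_)
open import Data.List using (List; []; _∷_; map; foldr; filter; length; concatMap)
open import Data.List.Base using (allFin)
open import Data.List.Membership.Propositional using (_∈_)
open import Data.Product using (Σ; _×_; _,_; ∃)
open import Relation.Nullary using (¬_; Dec; yes; no)
open import Relation.Nullary.Decidable using (⌊_⌋)
open import Relation.Binary.PropositionalEquality using (_≡_)

record IsField {c ℓ : Level} (R : CommutativeRing c ℓ) : Set (c ⊔ ℓ) where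
  open CommutativeRing R
  field
    1≉0     : ¬ (1# ≈ 0#)
    inverse : ∀ x → ¬ (x ≈ 0#) → Σ Carrier (λ y → x * y ≈ 1#)

module _ {c ℓ : Level} (R : CommutativeRing c ℓ) where
  open CommutativeRing R

  fromℕ : ℕ → Carrier
  fromℕ zero    = 0#
  fromℕ (suc k) = 1# + fromℕ k

  CharZero : Set ℓ
  CharZero = ∀ k → fromℕ k ≈ 0# → k ≡ 0

  sumK : List Carrier → Carrier
  sumK = foldr _+_ 0#

  prodK : List Carrier → Carrier
  prodK = foldr _*_ 1#

  negOnePow : ℕ → Carrier
  negOnePow zero    = 1#
  negOnePow (suc k) = - negOnePow k

  sumUpTo : ℕ → (ℕ → Carrier) → Carrier
  sumUpTo zero    g = g 0
  sumUpTo (suc D) g = sumUpTo D g + g (suc D)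

  -- A polynomial of degree (at most) D given by its coefficients:
  -- Q(t) = Σ_{j ≤ D} coeff j * t^j.
  -- f satisfies the linear recurrence with characteristic polynomial Q if
  -- Σ_{j ≤ D} coeff j * f(n + j) = 0 for all but finitely many n.
  SatisfiesRecurrence : (ℕ → Carrier) → (ℕ × (ℕ → Carrier)) → Set ℓ
  SatisfiesRecurrence f (D , coeff) =
    ∃ λ n₀ → ∀ n → n₀ ≤ n → sumUpTo D (λ j → coeff j * f (n ℕ.+ j)) ≈ 0#

-- The projected vertex set V is Fin n.  Fixing a lift ṽ_a ∈ Ṽ of each
-- a ∈ V, every lifted vertex is uniquely ṽ_a + i·g̃, encoded as (a , i).
-- A projected edge is the class of (ṽ_a + i g̃ , ṽ_b + (i + k) g̃); it is
-- encoded by (src = a, tgt = b, shift = k) together with its weight.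

record Edge {c : Level} (n : ℕ) (K : Set c) : Set c where
  constructor edge
  field
    src tgt : Fin n
    shift   : ℤ
    wt      : K
open Edge public

-- the underlying ordered pair class (used to say E is a *set* of pairs)
edgeKey : ∀ {c} {n : ℕ} {K : Set c} → Edge n K → Fin n × Fin n × ℤ
edgeKey e = src e , tgt e , shift e

LVertex : ℕ → Set
LVertex n = Fin n × ℤ

module Net {c ℓ : Level} (R : CommutativeRing c ℓ) (n : ℕ) where
  open CommutativeRing R

  E = Edge n Carrier

  data Path (es : List E) : LVertex n → LVertex n → Set c where
    []   : ∀ {x} → Path es x x
    step : ∀ {a i y} (e : E) → e ∈ es → src e ≡ a →
           Path es (tgt e , i ℤ.+ shift e) y → Path es (a , i) y

  pathLength : ∀ {es x y} → Path es x y → ℕ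
  pathLength []             = 0
  pathLength (step _ _ _ p) = suc (pathLength p)

  Acyclic : List E → Set c
  Acyclic es = ∀ a i ℓ′ (p : Path es (a , i) (a , i ℤ.+ ℓ′)) →
               1 ≤ pathLength p → ℤ.+0 ℤ.< ℓ′

  W : List E → ℕ → LVertex n → LVertex n → Carrier
  W es zero    (a , i) (b , j) = if ⌊ a ≟ b ⌋ ∧ ⌊ i ℤ.≟ j ⌋ then 1# else 0#
  W es (suc k) (a , i) y =
    sumK R (map (λ e → if ⌊ src e ≟ a ⌋
                         then wt e * W es k (tgt e , i ℤ.+ shift e) y
                         else 0#) es)

  -- Ñ(x,y) computed over paths of length ≤ L (equals the full path sum
  -- as soon as every path from x to y has length ≤ L)
  pathSum : List E → ℕ → LVertex n → LVertex n → Carrier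
  pathSum es L x y = sumUpTo R L (λ k → W es k x y)

  -- A collection of pairwise vertex-
  -- disjoint simple cycles is the same as its set S of edges, which is
  -- exactly a set of edges in which every vertex has in-degree and
  -- out-degree both equal to 0 or both equal to 1.

  subsets : List E → List (List E)
  subsets []       = [] ∷ []
  subsets (e ∷ es) = let r = subsets es in map (e ∷_) r Data.List.++ r

  outdeg indeg : List E → Fin n → ℕ
  outdeg S v = length (filter (λ e → src e ≟ v) S)
  indeg  S v = length (filter (λ e → tgt e ≟ v) S)

  isMulticycle : List E → Bool
  isMulticycle S =
    foldr _∧_ true
      (map (λ v → ⌊ outdeg S v ℕ.≤? 1 ⌋ ∧ ⌊ outdeg S v ℕ.≟ indeg S v ⌋) (allFin n))

  multicycles : List E → List (List E)
  multicycles es = filter (λ S → T? S) (subsets es)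
    where
      T? : (S : List E) → Dec (T (isMulticycle S))
      T? S with isMulticycle S
      ... | true  = yes _
      ... | false = no (λ ())

  -- the successor of v along the cycle of S through v (v itself if none)
  next : List E → Fin n → Fin n
  next []      v = v
  next (e ∷ S) v = if ⌊ src e ≟ v ⌋ then tgt e else next S v

  iter : ℕ → (Fin n → Fin n) → Fin n → Fin n
  iter zero    s v = v
  iter (suc k) s v = s (iter k s v)

  -- v is the smallest vertex of its cycle in S
  isCycleMin : List E → Fin n → Bool
  isCycleMin S v =
    ⌊ outdeg S v ℕ.≟ 1 ⌋ ∧
    foldr _∧_ true
      (map (λ k → ⌊ toℕ v ℕ.≤? toℕ (iter (toℕ k) (next S) v) ⌋) (allFin n))

  numCycles : List E → ℕ
  numCycles S = length (filter (λ v → isCycleMin S v Data.Bool.≟ true) (allFin n))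

  wind : List E → ℤ
  wind S = foldr ℤ._+_ (ℤ.+ 0) (map shift S)

  weight : List E → Carrier
  weight S = prodK R (map wt S)

  maxWind : List E → ℤ
  maxWind es = foldr ℤ._⊔_ (ℤ.+ 0) (map wind (multicycles es))

  -- Q_N(t) = Σ_r (-1)^(d-r) Σ_{C ∈ 𝒞^r(N)} t^(d - wind C) wt(C),
  -- as (degree d , coefficient function)
  charPoly : List E → ℕ × (ℕ → Carrier)
  charPoly es = ℤ.∣ d ∣ , coeff
    where
      d = maxWind es
      term : ℕ → List E → Carrier
      term j S = if ⌊ ℤ.∣ d ℤ.- wind S ∣ ℕ.≟ j ⌋
                   then negOnePow R ℤ.∣ d ℤ.- ℤ.+ numCycles S ∣ * weight S
                   else 0#
      coeff : ℕ → Carrier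
      coeff j = sumK R (map (term j) (multicycles es))

module Submission where

-- Proof (sign-reversing involution).  For n ≥ n₀ the recurrence sum
-- Σ_k q_k f(n + k) is a signed sum over pairs (C , P) of a multicycle C
-- of N and a walk P in Ñ from (a , i) to (b , j + n + d - wind C), of
-- (-1)^(d - r(C)) wt(C) wt(P).  Follow P from a to the first vertex that
-- was visited before or lies on C: in the first case move the closed
-- cycle from P to C, in the second move the cycle of C through it into P.
-- This keeps the end point and the weight and changes r(C) by one, so it
-- is a sign-reversing involution; it applies to every pair because for
-- n ≥ n₀ no such walk is simple.  Hence the sum vanishes.

open import Algebra.Bundles using (CommutativeMonoid; CommutativeRing; AbelianGroup)
open import Relation.Binary.Definitions using (DecidableEquality)
open import Data.Nat using (ℕ; _≤_)
open import Data.Integer as ℤ using (ℤ)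
open import Data.Fin using (Fin)
open import Data.List using (List)
open import Data.Product using (_,_)
open import Defs using (Edge; module Net)

module BoolFacts where

  open import Data.Bool using (Bool; true; false; _∧_)
  open import Data.List using (List; []; _∷_; map; foldr)
  open import Data.List.Membership.Propositional using (_∈_)
  open import Data.List.Relation.Unary.Any using (here; there)
  open import Data.Product using (_×_; _,_)
  open import Relation.Nullary using (Dec; yes; no)
  open import Data.Empty using (⊥-elim)
  open import Relation.Nullary.Decidable using (⌊_⌋)
  open import Relation.Binary.PropositionalEquality as ≡ using (_≡_)

  true-witness : ∀ {p} {P : Set p} (d : Dec P) → ⌊ d ⌋ ≡ true → P
  true-witness (yes p) _ = p

  witness-true : ∀ {p} {P : Set p} (d : Dec P) → P → ⌊ d ⌋ ≡ true
  witness-true (yes _) _ = ≡.refl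
  witness-true (no ¬p) p = ⊥-elim (¬p p)

  ∧-true⁻ : ∀ {a b : Bool} → (a ∧ b) ≡ true → a ≡ true × b ≡ true
  ∧-true⁻ {true} {true} _ = ≡.refl , ≡.refl

  bool-ext : ∀ {a b : Bool} → (a ≡ true → b ≡ true) → (b ≡ true → a ≡ true) → a ≡ b
  bool-ext {true}  {true}  _ _ = ≡.refl
  bool-ext {true}  {false} f _ = ≡.sym (f ≡.refl)
  bool-ext {false} {true}  _ g = g ≡.refl
  bool-ext {false} {false} _ _ = ≡.refl

  all-true⁻ : ∀ {a} {A : Set a} (f : A → Bool) (xs : List A) →
              foldr _∧_ true (map f xs) ≡ true → ∀ x → x ∈ xs → f x ≡ true
  all-true⁻ f (y ∷ xs) eq x x∈ with f y in fy
  all-true⁻ f (y ∷ xs) eq x (here ≡.refl) | true = fy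
  all-true⁻ f (y ∷ xs) eq x (there x∈)    | true = all-true⁻ f xs eq x x∈

  all-true⁺ : ∀ {a} {A : Set a} (f : A → Bool) (xs : List A) →
              (∀ x → x ∈ xs → f x ≡ true) → foldr _∧_ true (map f xs) ≡ true
  all-true⁺ f []       _   = ≡.refl
  all-true⁺ f (y ∷ xs) all rewrite all y (here ≡.refl) = all-true⁺ f xs (λ x x∈ → all x (there x∈))

module ListFacts where

  open import Data.List using (List; []; _∷_; _++_; take; drop; length)
  open import Data.List.Membership.Propositional using (_∈_; _∉_)
  open import Data.List.Membership.Propositional.Properties using (∈-++⁺ʳ)
  open import Data.List.Relation.Unary.Any using (here; there)
  open import Data.List.Relation.Unary.All using (All; []; _∷_) renaming (lookup to All-lookup)
  open import Data.List.Relation.Unary.AllPairs using ([]; _∷_)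
  open import Data.List.Relation.Unary.Unique.Propositional using (Unique)
  open import Data.Product using (_×_; _,_)
  open import Relation.Binary.PropositionalEquality as ≡ using (_≡_)

  module _ {a} {A : Set a} where

    Unique-++⁻ : ∀ (xs ys : List A) → Unique (xs ++ ys) → Unique xs × Unique ys × (∀ {y} → y ∈ ys → y ∉ xs)
    Unique-++⁻ []       ys ys!          = [] , ys! , (λ _ ())
    Unique-++⁻ (x ∷ xs) ys (x∉ ∷ xsys!) with Unique-++⁻ xs ys xsys!
    ... | xs! , ys! , disjoint = All-prefix x∉ ∷ xs! , ys! , disjoint′
      where
      disjoint′ : ∀ {y} → y ∈ ys → y ∉ x ∷ xs
      disjoint′ y∈ (here ≡.refl) = All-lookup x∉ (∈-++⁺ʳ xs y∈) ≡.refl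
      disjoint′ y∈ (there y∈xs)  = disjoint y∈ y∈xs
      All-prefix : ∀ {p} {P : A → Set p} {zs} → All P (zs ++ ys) → All P zs
      All-prefix {zs = []}     _        = []
      All-prefix {zs = z ∷ zs} (pz ∷ ps) = pz ∷ All-prefix ps

    take-length-++ : ∀ (xs ys : List A) → take (length xs) (xs ++ ys) ≡ xs
    take-length-++ []       ys = ≡.refl
    take-length-++ (x ∷ xs) ys = ≡.cong (x ∷_) (take-length-++ xs ys)

    drop-length-++ : ∀ (xs ys : List A) → drop (length xs) (xs ++ ys) ≡ ys
    drop-length-++ []       ys = ≡.refl
    drop-length-++ (x ∷ xs) ys = drop-length-++ xs ys

module LeastWitness where

  open import Data.Nat using (ℕ; zero; suc; _≤_; _<_)
  import Data.Nat.Properties as ℕP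
  open import Data.Product using (_×_; _,_; ∃)
  open import Data.Sum using (_⊎_; inj₁; inj₂)
  open import Relation.Nullary using (¬_; Dec; yes; no)
  open import Relation.Binary.PropositionalEquality as ≡ using (_≡_)
  open import Data.Empty using (⊥-elim)

  module _ {p} (P : ℕ → Set p) (P? : ∀ q → Dec (P q)) where

    search : ∀ B → (∀ q → q < B → ¬ P q) ⊎ (∃ λ L → L < B × P L × (∀ q → q < L → ¬ P q))
    search zero = inj₁ (λ q ())
    search (suc B) with search B
    ... | inj₂ (L , L<B , PL , below) = inj₂ (L , ℕP.m≤n⇒m≤1+n L<B , PL , below)
    ... | inj₁ none with P? B
    ...   | yes PB  = inj₂ (B , ℕP.≤-refl , PB , none)
    ...   | no  ¬PB = inj₁ (λ q q<1+B → below-or-at (ℕP.m≤n⇒m<n∨m≡n (ℕP.≤-pred q<1+B)))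
      where
      below-or-at : ∀ {q} → q < B ⊎ q ≡ B → ¬ P q
      below-or-at (inj₁ q<B)    = none _ q<B
      below-or-at (inj₂ ≡.refl) = ¬PB

    least : ∀ B → P B → ∃ λ L → L ≤ B × P L × (∀ q → q < L → ¬ P q)
    least B PB with search (suc B)
    ... | inj₁ none                  = ⊥-elim (none B ℕP.≤-refl PB)
    ... | inj₂ (L , L<1+B , PL , below) = L , ℕP.≤-pred L<1+B , PL , below

module BigSums {c ℓ} (CM : CommutativeMonoid c ℓ) where

  open import Data.Bool using (Bool; true; false; if_then_else_; _∨_; T)
  open import Data.Nat using (suc)
  open import Data.Fin using (Fin; zero; suc)
  open import Data.Fin.Properties using (_≟_)
  open import Data.List using (List; []; _∷_; _++_; map; foldr; filter; tabulate; allFin; cartesianProductWith)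
  import Data.List.Properties as LP
  open import Data.List.Membership.Propositional using (_∈_)
  open import Data.List.Relation.Unary.Any using (here; there)
  open import Relation.Nullary using (Dec; yes; no; does)
  open import Data.Unit using (tt)
  open import Data.Empty using (⊥-elim)
  open import Relation.Binary.PropositionalEquality as ≡ using (_≡_)
  open import Function using (_∘_)

  open CommutativeMonoid CM renaming (Carrier to A)
  open import Algebra.Properties.CommutativeSemigroup commutativeSemigroup using (interchange)
  open import Relation.Binary.Reasoning.Setoid setoid

  Sum : ∀ {b} {B : Set b} → (B → A) → List B → A
  Sum g xs = foldr _∙_ ε (map g xs)

  Sum-cong : ∀ {b} {B : Set b} {g h : B → A} (xs : List B) → (∀ x → x ∈ xs → g x ≈ h x) → Sum g xs ≈ Sum h xs
  Sum-cong []       eq = refl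
  Sum-cong (x ∷ xs) eq = ∙-cong (eq x (here ≡.refl)) (Sum-cong xs (λ y y∈ → eq y (there y∈)))

  Sum-cong′ : ∀ {b} {B : Set b} {g h : B → A} (xs : List B) → (∀ x → g x ≈ h x) → Sum g xs ≈ Sum h xs
  Sum-cong′ xs eq = Sum-cong xs (λ x _ → eq x)

  Sum-ε : ∀ {b} {B : Set b} {g : B → A} (xs : List B) → (∀ x → x ∈ xs → g x ≈ ε) → Sum g xs ≈ ε
  Sum-ε []       eq = refl
  Sum-ε (x ∷ xs) eq = trans (∙-cong (eq x (here ≡.refl)) (Sum-ε xs (λ y y∈ → eq y (there y∈)))) (identityˡ ε)

  Sum-++ : ∀ {b} {B : Set b} (g : B → A) (xs ys : List B) → Sum g (xs ++ ys) ≈ Sum g xs ∙ Sum g ys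
  Sum-++ g []       ys = sym (identityˡ _)
  Sum-++ g (x ∷ xs) ys = trans (∙-congˡ (Sum-++ g xs ys)) (sym (assoc _ _ _))

  Sum-∙ : ∀ {b} {B : Set b} (g h : B → A) (xs : List B) → Sum (λ x → g x ∙ h x) xs ≈ Sum g xs ∙ Sum h xs
  Sum-∙ g h []       = sym (identityˡ ε)
  Sum-∙ g h (x ∷ xs) = trans (∙-congˡ (Sum-∙ g h xs)) (interchange _ _ _ _)

  Sum-map : ∀ {b} {B : Set b} {d} {D : Set d} (g : D → A) (f : B → D) (xs : List B) → Sum g (map f xs) ≡ Sum (g ∘ f) xs
  Sum-map g f xs = ≡.cong (foldr _∙_ ε) (≡.sym (LP.map-∘ xs))

  Sum-cartesianProductWith : ∀ {b} {B : Set b} {d e} {D : Set d} {X : Set e} (g : X → A) (f : B → D → X) (xs : List B) (ys : List D) →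
                             Sum g (cartesianProductWith f xs ys) ≈ Sum (λ x → Sum (λ y → g (f x y)) ys) xs
  Sum-cartesianProductWith g f []       ys = refl
  Sum-cartesianProductWith g f (x ∷ xs) ys =
    trans (Sum-++ g (map (f x) ys) _) (∙-cong (reflexive (Sum-map g (f x) ys)) (Sum-cartesianProductWith g f xs ys))

  Sum-filter : ∀ {b} {B : Set b} (f : B → Bool) (T? : (x : B) → Dec (T (f x))) (g : B → A) xs →
               Sum g (filter T? xs) ≈ Sum (λ x → if f x then g x else ε) xs
  Sum-filter f T? g [] = refl
  Sum-filter f T? g (x ∷ xs) with f x | T? x
  ... | true  | yes _ = ∙-congˡ (Sum-filter f T? g xs)
  ... | true  | no ¬p = ⊥-elim (¬p tt)
  ... | false | no _  = trans (Sum-filter f T? g xs) (sym (identityˡ _))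

  Sum-tabulate : ∀ {b} {B : Set b} {n} (g : B → A) (f : Fin n → B) → Sum g (tabulate f) ≡ Sum (g ∘ f) (allFin n)
  Sum-tabulate g f = ≡.cong (foldr _∙_ ε) (≡.trans (LP.map-tabulate f g) (≡.sym (LP.map-tabulate (λ x → x) (g ∘ f))))

  Sum-allFin-suc : ∀ {n} (g : Fin (suc n) → A) → Sum g (allFin (suc n)) ≡ g zero ∙ Sum (g ∘ suc) (allFin n)
  Sum-allFin-suc g = ≡.cong (g zero ∙_) (Sum-tabulate g suc)

  Sum-delta : ∀ {n} (h : Fin n → A) (c : Fin n) → Sum (λ k → if does (k ≟ c) then h k else ε) (allFin n) ≈ h c
  Sum-delta {suc n} h zero = begin
    Sum (λ k → if does (k ≟ zero) then h k else ε) (allFin (suc n))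
      ≡⟨ Sum-allFin-suc (λ k → if does (k ≟ zero) then h k else ε) ⟩
    h zero ∙ Sum (λ _ → ε) (allFin n) ≈⟨ ∙-congˡ (Sum-ε (allFin n) (λ _ _ → refl)) ⟩
    h zero ∙ ε                        ≈⟨ identityʳ _ ⟩
    h zero ∎
  Sum-delta {suc n} h (suc c) = begin
    Sum (λ k → if does (k ≟ suc c) then h k else ε) (allFin (suc n))
      ≡⟨ Sum-allFin-suc (λ k → if does (k ≟ suc c) then h k else ε) ⟩
    ε ∙ Sum (λ k → if does (suc k ≟ suc c) then h (suc k) else ε) (allFin n)
      ≈⟨ identityˡ _ ⟩
    Sum (λ k → if does (suc k ≟ suc c) then h (suc k) else ε) (allFin n)
      ≈⟨ Sum-cong′ (allFin n) shift ⟩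
    Sum (λ k → if does (k ≟ c) then h (suc k) else ε) (allFin n)
      ≈⟨ Sum-delta (h ∘ suc) c ⟩
    h (suc c) ∎
    where
    shift : ∀ k → (if does (suc k ≟ suc c) then h (suc k) else ε) ≈ (if does (k ≟ c) then h (suc k) else ε)
    shift k with k ≟ c
    ... | yes _ = refl
    ... | no  _ = refl

  if-∨ : (b₁ b₂ : Bool) (v : A) → (b₁ ≡ true → b₂ ≡ false) →
         (if b₁ ∨ b₂ then v else ε) ≈ (if b₁ then v else ε) ∙ (if b₂ then v else ε)
  if-∨ true  true  v disj with disj ≡.refl
  ... | ()
  if-∨ true  false v disj = sym (identityʳ v)
  if-∨ false true  v disj = sym (identityˡ v)
  if-∨ false false v disj = sym (identityˡ ε)

module NatSums where

  open import Data.Bool using (Bool; true; false; if_then_else_)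
  import Data.Bool as Bool
  open import Data.Nat using (ℕ; zero; suc; _+_; _≤_; z≤n; s≤s)
  import Data.Nat.Properties as ℕP
  open import Data.Fin using (Fin; zero; suc)
  open import Data.Fin.Properties using (_≟_; injective⇒≤)
  open import Data.List as L using (List; []; _∷_; filter; length; allFin)
  open import Data.List.Membership.Propositional using (_∈_; _∉_)
  open import Data.List.Membership.Propositional.Properties using (∈-lookup)
  open import Data.List.Relation.Unary.Any using (here; there)
  open import Data.List.Relation.Unary.All using () renaming (lookup to All-lookup)
  open import Data.List.Relation.Unary.AllPairs using (_∷_)
  open import Data.List.Relation.Unary.Unique.Propositional using (Unique)
  open import Relation.Nullary using (yes; no; does)
  open import Relation.Unary using (Pred; Decidable)
  open import Relation.Binary.PropositionalEquality as ≡ using (_≡_; _≢_)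
  open import Data.Empty using (⊥-elim)
  open import Function using (_∘_)

  open BigSums ℕP.+-0-commutativeMonoid public

  term≤Sum : ∀ {n} (h : Fin n → ℕ) k → h k ≤ Sum h (allFin n)
  term≤Sum h zero    rewrite Sum-allFin-suc h = ℕP.m≤m+n _ _
  term≤Sum h (suc k) rewrite Sum-allFin-suc h = ℕP.≤-trans (term≤Sum (h ∘ suc) k) (ℕP.m≤n+m _ _)

  two-terms≤Sum : ∀ {n} (h : Fin n → ℕ) k k′ → k ≢ k′ → h k + h k′ ≤ Sum h (allFin n)
  two-terms≤Sum h zero    zero     k≢k′ = ⊥-elim (k≢k′ ≡.refl)
  two-terms≤Sum h zero    (suc k′) _    rewrite Sum-allFin-suc h = ℕP.+-monoʳ-≤ (h zero) (term≤Sum (h ∘ suc) k′)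
  two-terms≤Sum h (suc k) zero     _    rewrite Sum-allFin-suc h | ℕP.+-comm (h (suc k)) (h zero) =
    ℕP.+-monoʳ-≤ (h zero) (term≤Sum (h ∘ suc) k)
  two-terms≤Sum h (suc k) (suc k′) k≢k′ rewrite Sum-allFin-suc h =
    ℕP.≤-trans (two-terms≤Sum (h ∘ suc) k k′ (k≢k′ ∘ ≡.cong suc)) (ℕP.m≤n+m _ _)

  length-filter≡Sum : ∀ {a p} {A : Set a} {P : Pred A p} (P? : Decidable P) (xs : List A) →
                      length (filter P? xs) ≡ Sum (λ x → if does (P? x) then 1 else 0) xs
  length-filter≡Sum P? []       = ≡.refl
  length-filter≡Sum P? (x ∷ xs) with does (P? x)
  ... | true  = ≡.cong suc (length-filter≡Sum P? xs)
  ... | false = length-filter≡Sum P? xs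

  length-filterB≡Sum : ∀ {a} {A : Set a} (f : A → Bool) (xs : List A) →
                       length (filter (λ x → f x Bool.≟ true) xs) ≡ Sum (λ x → if f x then 1 else 0) xs
  length-filterB≡Sum f xs = ≡.trans (length-filter≡Sum (λ x → f x Bool.≟ true) xs) (Sum-cong′ xs test≡)
    where
    test≡ : ∀ x → (if does (f x Bool.≟ true) then 1 else 0) ≡ (if f x then 1 else 0)
    test≡ x with f x
    ... | true  = ≡.refl
    ... | false = ≡.refl

  count : ∀ {N} → Fin N → List (Fin N) → ℕ
  count v = Sum (λ u → if does (u ≟ v) then 1 else 0)

  count-∉ : ∀ {N} (v : Fin N) us → v ∉ us → count v us ≡ 0
  count-∉ v []       _  = ≡.refl
  count-∉ v (u ∷ us) v∉ with u ≟ v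
  ... | yes ≡.refl = ⊥-elim (v∉ (here ≡.refl))
  ... | no  _      = count-∉ v us (v∉ ∘ there)

  count-∈ : ∀ {N} (v : Fin N) us → v ∈ us → 1 ≤ count v us
  count-∈ v (u ∷ us) (here ≡.refl) with v ≟ v
  ... | yes _   = s≤s z≤n
  ... | no  v≢v = ⊥-elim (v≢v ≡.refl)
  count-∈ v (u ∷ us) (there v∈) with u ≟ v
  ... | yes _ = s≤s z≤n
  ... | no  _ = count-∈ v us v∈

  count-unique : ∀ {N} (v : Fin N) us → Unique us → count v us ≤ 1
  count-unique v []       _          = z≤n
  count-unique v (u ∷ us) (u∉ ∷ us!) with u ≟ v
  ... | yes ≡.refl = s≤s (ℕP.≤-reflexive (count-∉ u us (λ p → All-lookup u∉ p ≡.refl)))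
  ... | no  _      = count-unique v us us!

  unique-length : ∀ {N} (us : List (Fin N)) → Unique us → length us ≤ N
  unique-length {N} us us! = injective⇒≤ (lookup-injective us us!)
    where
    lookup-injective : ∀ (us : List (Fin N)) → Unique us → ∀ {i j} → L.lookup us i ≡ L.lookup us j → i ≡ j
    lookup-injective (x ∷ us) (x∉ ∷ _)   {zero}  {zero}  _ = ≡.refl
    lookup-injective (x ∷ us) (x∉ ∷ _)   {zero}  {suc j} e = ⊥-elim (All-lookup x∉ (∈-lookup j) e)
    lookup-injective (x ∷ us) (x∉ ∷ _)   {suc i} {zero}  e = ⊥-elim (All-lookup x∉ (∈-lookup i) (≡.sym e))
    lookup-injective (x ∷ us) (_ ∷ us!) {suc i} {suc j} e = ≡.cong suc (lookup-injective us us! e)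

module RingSums {c ℓ} (R : CommutativeRing c ℓ) where

  open import Defs
  open import Data.Bool using (if_then_else_)
  open import Data.Nat as ℕ using (ℕ; zero; suc; _≤_; _<_; z≤n)
  import Data.Nat.Properties as ℕP
  open import Data.List using (List; []; _∷_)
  open import Data.Integer as ℤ using (ℤ)
  open import Data.Integer.Tactic.RingSolver using (solve-∀)
  import Algebra.Properties.Ring as RingProperties
  open import Relation.Nullary using (yes; no)
  open import Relation.Nullary.Decidable using (⌊_⌋)
  open import Relation.Binary.PropositionalEquality as ≡ using (_≡_)
  open import Data.Empty using (⊥-elim)

  open CommutativeRing R
  open BigSums +-commutativeMonoid public

  Sum-*ˡ : ∀ {a} {A : Set a} (k : Carrier) (g : A → Carrier) (xs : List A) →
           k * Sum g xs ≈ Sum (λ x → k * g x) xs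
  Sum-*ˡ k g []       = zeroʳ k
  Sum-*ˡ k g (x ∷ xs) = trans (distribˡ k _ _) (+-congˡ (Sum-*ˡ k g xs))

  Sum-*ʳ : ∀ {a} {A : Set a} (k : Carrier) (g : A → Carrier) (xs : List A) →
           Sum g xs * k ≈ Sum (λ x → g x * k) xs
  Sum-*ʳ k g xs = trans (*-comm _ _) (trans (Sum-*ˡ k g xs) (Sum-cong′ xs (λ x → *-comm _ _)))

  sumUpTo-cong : ∀ D {g h : ℕ → Carrier} → (∀ k → k ≤ D → g k ≈ h k) → sumUpTo R D g ≈ sumUpTo R D h
  sumUpTo-cong zero    eq = eq 0 z≤n
  sumUpTo-cong (suc D) eq = +-cong (sumUpTo-cong D (λ k k≤ → eq k (ℕP.m≤n⇒m≤1+n k≤))) (eq (suc D) ℕP.≤-refl)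

  sumUpTo-zero : ∀ D {g : ℕ → Carrier} → (∀ k → k ≤ D → g k ≈ 0#) → sumUpTo R D g ≈ 0#
  sumUpTo-zero zero    eq = eq 0 z≤n
  sumUpTo-zero (suc D) eq =
    trans (+-cong (sumUpTo-zero D (λ k k≤ → eq k (ℕP.m≤n⇒m≤1+n k≤))) (eq (suc D) ℕP.≤-refl)) (+-identityˡ 0#)

  sumUpTo-Sum : ∀ {a} {A : Set a} D (g : ℕ → A → Carrier) (xs : List A) →
                sumUpTo R D (λ k → Sum (g k) xs) ≈ Sum (λ x → sumUpTo R D (λ k → g k x)) xs
  sumUpTo-Sum zero    g xs = refl
  sumUpTo-Sum (suc D) g xs = trans (+-congʳ (sumUpTo-Sum D g xs)) (sym (Sum-∙ _ _ xs))

  sumUpTo-delta : ∀ D t (κ : Carrier) (h : ℕ → Carrier) → t ≤ D →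
                  sumUpTo R D (λ j → (if ⌊ t ℕ.≟ j ⌋ then κ else 0#) * h j) ≈ κ * h t
  sumUpTo-delta zero zero κ h _ = refl
  sumUpTo-delta (suc D) t κ h t≤ with t ℕ.≟ suc D
  ... | yes ≡.refl = trans (+-congʳ (sumUpTo-zero D off)) (+-identityˡ _)
    where
    off : ∀ j → j ≤ D → (if ⌊ suc D ℕ.≟ j ⌋ then κ else 0#) * h j ≈ 0#
    off j j≤ with suc D ℕ.≟ j
    ... | yes ≡.refl = ⊥-elim (ℕP.<-irrefl ≡.refl j≤)
    ... | no _       = zeroˡ _
  ... | no t≢ = trans (+-cong (sumUpTo-delta D t κ h (ℕP.≤-pred (ℕP.≤∧≢⇒< t≤ t≢))) (zeroˡ _)) (+-identityʳ _)

  sumUpTo-extend : ∀ K₀ K {g : ℕ → Carrier} → K₀ ≤ K → (∀ k → K₀ < k → k ≤ K → g k ≈ 0#) →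
                   sumUpTo R K g ≈ sumUpTo R K₀ g
  sumUpTo-extend K₀ zero    z≤n _ = refl
  sumUpTo-extend K₀ (suc K) le vanish with K₀ ℕ.≟ suc K
  ... | yes ≡.refl = refl
  ... | no K₀≢ = trans (+-cong (sumUpTo-extend K₀ K (ℕP.≤-pred (ℕP.≤∧≢⇒< le K₀≢)) (λ k lo hi → vanish k lo (ℕP.m≤n⇒m≤1+n hi)))
                               (vanish (suc K) (ℕP.≤∧≢⇒< le K₀≢) ℕP.≤-refl))
                       (+-identityʳ _)

  negOnePow-suc : ∀ (d : ℤ) r → negOnePow R ℤ.∣ d ℤ.- ℤ.+ suc r ∣ ≈ - negOnePow R ℤ.∣ d ℤ.- ℤ.+ r ∣
  negOnePow-suc d r = ≡.subst (λ z → negOnePow R ℤ.∣ z ∣ ≈ - negOnePow R ℤ.∣ d ℤ.- ℤ.+ r ∣) (regroup d (ℤ.+ r))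
                        (pred (d ℤ.- ℤ.+ r))
    where
    regroup : ∀ (d r : ℤ) → (d ℤ.- r) ℤ.- ℤ.+ 1 ≡ d ℤ.- (ℤ.+ 1 ℤ.+ r)
    regroup = solve-∀
    pred : ∀ x → negOnePow R ℤ.∣ x ℤ.- ℤ.+ 1 ∣ ≈ - negOnePow R ℤ.∣ x ∣
    pred (ℤ.+ zero)  = refl
    pred (ℤ.+ suc k) = sym (RingProperties.-‿involutive ring _)
    pred ℤ.-[1+ k ] rewrite ℕP.+-identityʳ k = refl

module SignReversingInvolution {c ℓ} (G : AbelianGroup c ℓ)
  {a} {X : Set a} (_≟_ : DecidableEquality X) where

  open import Data.Bool using (Bool; true; false)
  open import Data.Nat using (suc; _≤_; s≤s)
  import Data.Nat.Properties as ℕP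
  open import Data.List using (List; []; _∷_; filter; length)
  import Data.List.Properties as LP
  open import Data.List.Membership.Propositional using (_∈_; _∉_)
  open import Data.List.Membership.Propositional.Properties using (∈-filter⁺; ∈-filter⁻)
  open import Data.List.Relation.Unary.Any using (here; there)
  open import Data.List.Relation.Unary.All using () renaming (lookup to All-lookup)
  open import Data.List.Relation.Unary.Unique.Propositional using (Unique)
  open import Data.List.Relation.Unary.AllPairs using (_∷_)
  import Data.List.Relation.Unary.Unique.Propositional.Properties as UniqueP
  open import Data.Product using (_×_; _,_; proj₁; proj₂)
  open import Relation.Nullary using (yes; no; ¬?)
  open import Relation.Binary.PropositionalEquality as ≡ using (_≡_; _≢_)
  open import Data.Empty using (⊥-elim)

  open AbelianGroup G renaming (Carrier to A)
  open BigSums commutativeMonoid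
  open import Relation.Binary.Reasoning.Setoid setoid

  remove : X → List X → List X
  remove z = filter (λ x → ¬? (x ≟ z))

  remove-∉ : ∀ z ys → z ∉ ys → remove z ys ≡ ys
  remove-∉ z []       _  = ≡.refl
  remove-∉ z (y ∷ ys) z∉ with y ≟ z
  ... | yes ≡.refl = ⊥-elim (z∉ (here ≡.refl))
  ... | no  _      = ≡.cong (y ∷_) (remove-∉ z ys (λ p → z∉ (there p)))

  Sum-remove : (g : X → A) → ∀ z ys → Unique ys → z ∈ ys → Sum g ys ≈ g z ∙ Sum g (remove z ys)
  Sum-remove g z (y ∷ ys) (y∉ ∷ u) (here ≡.refl) with y ≟ y
  ... | yes _ = ∙-congˡ (reflexive (≡.cong (Sum g) (≡.sym (remove-∉ y ys (λ p → All-lookup y∉ p ≡.refl)))))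
  ... | no y≢y = ⊥-elim (y≢y ≡.refl)
  Sum-remove g z (y ∷ ys) (y∉ ∷ u) (there z∈) with y ≟ z
  ... | yes ≡.refl = ⊥-elim (All-lookup y∉ z∈ ≡.refl)
  ... | no _ = begin
    g y ∙ Sum g ys                          ≈⟨ ∙-congˡ (Sum-remove g z ys u z∈) ⟩
    g y ∙ (g z ∙ Sum g (remove z ys))       ≈⟨ assoc _ _ _ ⟨
    (g y ∙ g z) ∙ Sum g (remove z ys)       ≈⟨ ∙-congʳ (comm _ _) ⟩
    (g z ∙ g y) ∙ Sum g (remove z ys)       ≈⟨ assoc _ _ _ ⟩
    g z ∙ (g y ∙ Sum g (remove z ys))       ∎

  module _ (valid : X → Bool) (ι : X → X) (g : X → A)
           (involutive : ∀ x → valid x ≡ true →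
              valid (ι x) ≡ true × ι (ι x) ≡ x × ι x ≢ x × g (ι x) ≈ g x ⁻¹)
           (invalid-zero : ∀ x → valid x ≡ false → g x ≈ ε) where

    Closed : List X → Set a
    Closed ys = ∀ x → x ∈ ys → valid x ≡ true → ι x ∈ ys

    private
      ι-valid : ∀ x y → valid x ≡ true → ι x ≡ y → valid y ≡ true
      ι-valid x y vx ≡.refl = proj₁ (involutive x vx)

    Sum-vanishes′ : ∀ fuel ys → length ys ≤ fuel → Unique ys → Closed ys → Sum g ys ≈ ε
    Sum-vanishes′ _ [] _ _ _ = refl
    Sum-vanishes′ (suc fuel) (y ∷ ys) (s≤s len) (y∉ ∷ u) closed with valid y in vy
    ... | false = trans (∙-cong (invalid-zero y vy) (Sum-vanishes′ fuel ys len u closed′)) (identityˡ ε)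
      where
      closed′ : Closed ys
      closed′ x x∈ vx with closed x (there x∈) vx
      ... | there p    = p
      ... | here ιx≡y with ≡.trans (≡.sym (ι-valid x y vx ιx≡y)) vy
      ...   | ()
    ... | true with involutive y vy | closed y (here ≡.refl) vy
    ...   | _ , _ , ιy≢y , _ | here ιy≡y = ⊥-elim (ιy≢y ιy≡y)
    ...   | _ , ιιy≡y , _ , gιy | there ιy∈ = begin
      g y ∙ Sum g ys                                 ≈⟨ ∙-congˡ (Sum-remove g (ι y) ys u ιy∈) ⟩
      g y ∙ (g (ι y) ∙ Sum g (remove (ι y) ys))     ≈⟨ assoc _ _ _ ⟨
      (g y ∙ g (ι y)) ∙ Sum g (remove (ι y) ys)     ≈⟨ ∙-cong (trans (∙-congˡ gιy) (inverseʳ _)) rest ⟩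
      ε ∙ ε                                          ≈⟨ identityˡ ε ⟩
      ε ∎
      where
      rest : Sum g (remove (ι y) ys) ≈ ε
      rest = Sum-vanishes′ fuel (remove (ι y) ys) (ℕP.≤-trans (LP.length-filter _ ys) len) (UniqueP.filter⁺ _ u) closed′
        where
        closed′ : Closed (remove (ι y) ys)
        closed′ x x∈ vx with ∈-filter⁻ (λ x → ¬? (x ≟ ι y)) {xs = ys} x∈
        ... | x∈ys , x≢ιy with closed x (there x∈ys) vx
        ... | here ιx≡y  = ⊥-elim (x≢ιy (≡.trans (≡.sym (proj₁ (proj₂ (involutive x vx)))) (≡.cong ι ιx≡y)))
        ... | there ιx∈ = ∈-filter⁺ (λ x → ¬? (x ≟ ι y)) ιx∈ ιx≢ιy
          where
          ιx≢ιy : ι x ≢ ι y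
          ιx≢ιy ιx≡ιy = All-lookup y∉ x∈ys (≡.trans (≡.sym ιιy≡y)
                          (≡.trans (≡.cong ι (≡.sym ιx≡ιy)) (proj₁ (proj₂ (involutive x vx)))))

    Sum-vanishes : ∀ xs → Unique xs → Closed xs → Sum g xs ≈ ε
    Sum-vanishes xs = Sum-vanishes′ (length xs) xs ℕP.≤-refl

module Masks where

  open import Data.Bool using (Bool; true; false; if_then_else_; _∧_; _∨_; not)
  open import Data.Bool.Properties using (∨-zeroʳ; ∧-zeroʳ; ∨-identityʳ; ∧-identityʳ)
  open import Data.Nat using (ℕ; zero; suc)
  open import Data.Fin using (Fin)
  open import Data.Fin.Properties using (_≟_)
  open import Data.List as L using (List; []; _∷_; _++_; map; length; allFin)
  open import Data.List.Membership.Propositional using (_∈_; _∉_)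
  open import Data.List.Membership.Propositional.Properties using (∈-map⁺; ∈-map⁻; ∈-++⁺ˡ; ∈-++⁺ʳ)
  open import Data.List.Relation.Unary.Any using (here)
  import Data.List.Relation.Unary.All as All
  open All using () renaming (lookup to All-lookup)
  open import Data.List.Relation.Unary.AllPairs using ([]; _∷_)
  open import Data.List.Relation.Unary.Unique.Propositional using (Unique)
  import Data.List.Relation.Unary.Unique.Propositional.Properties as UniqueP
  open import Data.Vec as Vec using (Vec; []; _∷_; lookup)
  open import Data.Vec.Properties using (lookup∘tabulate; tabulate-cong; tabulate∘lookup; ∷-injectiveʳ)
  open import Data.Product using (_,_)
  open import Relation.Nullary using (yes; does)
  open import Data.Empty using (⊥)
  open import Relation.Nullary.Decidable using (dec-true; dec-false; isYes≗does)
  open import Relation.Binary.PropositionalEquality as ≡ using (_≡_)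
  open import Algebra.Bundles using (CommutativeMonoid)
  open BoolFacts using (true-witness)

  module _ {m : ℕ} where
    open import Data.List.Membership.DecPropositional (_≟_ {m}) using (_∈?_)

    memB : Fin m → List (Fin m) → Bool
    memB k cs = does (k ∈? cs)

    memB-∈ : ∀ {k cs} → k ∈ cs → memB k cs ≡ true
    memB-∈ {k} {cs} = dec-true (k ∈? cs)

    memB-∉ : ∀ {k cs} → k ∉ cs → memB k cs ≡ false
    memB-∉ {k} {cs} = dec-false (k ∈? cs)

    memB-true : ∀ {k cs} → memB k cs ≡ true → k ∈ cs
    memB-true {k} {cs} k∈ = true-witness (k ∈? cs) (≡.trans (isYes≗does (k ∈? cs)) k∈)

    setBits clearBits : List (Fin m) → Vec Bool m → Vec Bool m
    setBits   cs M = Vec.tabulate (λ k → lookup M k ∨ memB k cs)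
    clearBits cs M = Vec.tabulate (λ k → lookup M k ∧ not (memB k cs))

    setBits-∈ : ∀ M cs k → k ∈ cs → lookup (setBits cs M) k ≡ true
    setBits-∈ M cs k k∈
      rewrite lookup∘tabulate (λ k → lookup M k ∨ memB k cs) k | memB-∈ k∈ = ∨-zeroʳ (lookup M k)

    setBits-mono : ∀ M cs k → lookup M k ≡ true → lookup (setBits cs M) k ≡ true
    setBits-mono M cs k Mk rewrite lookup∘tabulate (λ k → lookup M k ∨ memB k cs) k | Mk = ≡.refl

    clearBits-∈ : ∀ M cs k → k ∈ cs → lookup (clearBits cs M) k ≡ false
    clearBits-∈ M cs k k∈
      rewrite lookup∘tabulate (λ k → lookup M k ∧ not (memB k cs)) k | memB-∈ k∈ = ∧-zeroʳ (lookup M k)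

    setBits-clearBits : ∀ cs M → (∀ k → k ∈ cs → lookup M k ≡ true) → setBits cs (clearBits cs M) ≡ M
    setBits-clearBits cs M on = ≡.trans (tabulate-cong pointwise) (tabulate∘lookup M)
      where
      pointwise : ∀ k → lookup (clearBits cs M) k ∨ memB k cs ≡ lookup M k
      pointwise k rewrite lookup∘tabulate (λ k → lookup M k ∧ not (memB k cs)) k with memB k cs in k∈?
      ... | true  = ≡.trans (∨-zeroʳ _) (≡.sym (on k (memB-true k∈?)))
      ... | false = ≡.trans (∨-identityʳ _) (∧-identityʳ (lookup M k))

    clearBits-setBits : ∀ cs M → (∀ k → k ∈ cs → lookup M k ≡ false) → clearBits cs (setBits cs M) ≡ M
    clearBits-setBits cs M off = ≡.trans (tabulate-cong pointwise) (tabulate∘lookup M)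
      where
      pointwise : ∀ k → lookup (setBits cs M) k ∧ not (memB k cs) ≡ lookup M k
      pointwise k rewrite lookup∘tabulate (λ k → lookup M k ∨ memB k cs) k with memB k cs in k∈?
      ... | true  = ≡.trans (∧-zeroʳ _) (≡.sym (off k (memB-true k∈?)))
      ... | false = ≡.trans (∧-identityʳ _) (∨-identityʳ (lookup M k))

  masks : (n : ℕ) → List (Vec Bool n)
  masks zero    = [] ∷ []
  masks (suc n) = map (true ∷_) (masks n) ++ map (false ∷_) (masks n)

  masks-complete : ∀ n (M : Vec Bool n) → M ∈ masks n
  masks-complete zero    []          = here ≡.refl
  masks-complete (suc n) (true ∷ M)  = ∈-++⁺ˡ (∈-map⁺ (true ∷_) (masks-complete n M))
  masks-complete (suc n) (false ∷ M) = ∈-++⁺ʳ (map (true ∷_) (masks n)) (∈-map⁺ (false ∷_) (masks-complete n M))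

  masks-unique : ∀ n → Unique (masks n)
  masks-unique zero    = All.[] ∷ []
  masks-unique (suc n) = UniqueP.++⁺ (UniqueP.map⁺ ∷-injectiveʳ (masks-unique n)) (UniqueP.map⁺ ∷-injectiveʳ (masks-unique n))
                           (λ (p , q) → disjoint p q)
    where
    disjoint : ∀ {v : Vec Bool (suc n)} → v ∈ map (true ∷_) (masks n) → v ∈ map (false ∷_) (masks n) → ⊥
    disjoint p q with ∈-map⁻ (true ∷_) p | ∈-map⁻ (false ∷_) q
    ... | _ , _ , ≡.refl | _ , _ , ()

  select : ∀ {a} {E : Set a} (xs : List E) → Vec Bool (length xs) → List E
  select []       []          = []
  select (x ∷ xs) (true ∷ M)  = x ∷ select xs M
  select (x ∷ xs) (false ∷ M) = select xs M

  module MaskedSums {c ℓ} (CM : CommutativeMonoid c ℓ) where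
    open CommutativeMonoid CM renaming (Carrier to A)
    open BigSums CM public
    open import Relation.Binary.Reasoning.Setoid setoid

    SumMask : ∀ {m} → Vec Bool m → (Fin m → A) → A
    SumMask {m} M h = Sum (λ k → if lookup M k then h k else ε) (allFin m)

    Sum-memB : ∀ {m} (h : Fin m → A) (cs : List (Fin m)) → Unique cs →
               Sum (λ k → if memB k cs then h k else ε) (allFin m) ≈ Sum h cs
    Sum-memB {m} h []       _         = Sum-ε (allFin m) (λ _ _ → refl)
    Sum-memB {m} h (c ∷ cs) (c∉ ∷ cs!) = begin
      Sum (λ k → if does (k ≟ c) ∨ memB k cs then h k else ε) (allFin m)
        ≈⟨ Sum-cong′ (allFin m) (λ k → if-∨ (does (k ≟ c)) (memB k cs) (h k) (disjoint k)) ⟩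
      Sum (λ k → (if does (k ≟ c) then h k else ε) ∙ (if memB k cs then h k else ε)) (allFin m)
        ≈⟨ Sum-∙ _ _ (allFin m) ⟩
      Sum (λ k → if does (k ≟ c) then h k else ε) (allFin m) ∙ Sum (λ k → if memB k cs then h k else ε) (allFin m)
        ≈⟨ ∙-cong (Sum-delta h c) (Sum-memB h cs cs!) ⟩
      h c ∙ Sum h cs ∎
      where
      disjoint : ∀ k → does (k ≟ c) ≡ true → memB k cs ≡ false
      disjoint k k≡c with k ≟ c
      ... | yes ≡.refl = memB-∉ (λ c∈ → All-lookup c∉ c∈ ≡.refl)

    SumMask-setBits : ∀ {m} (h : Fin m → A) (cs : List (Fin m)) (M : Vec Bool m) → Unique cs →
                      (∀ k → k ∈ cs → lookup M k ≡ false) →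
                      SumMask (setBits cs M) h ≈ SumMask M h ∙ Sum h cs
    SumMask-setBits {m} h cs M cs! off = begin
      SumMask (setBits cs M) h
        ≈⟨ Sum-cong′ (allFin m) (λ k → reflexive (≡.cong (λ b → if b then h k else ε) (lookup∘tabulate _ k))) ⟩
      Sum (λ k → if lookup M k ∨ memB k cs then h k else ε) (allFin m)
        ≈⟨ Sum-cong′ (allFin m) (λ k → if-∨ (lookup M k) (memB k cs) (h k) (disjoint k)) ⟩
      Sum (λ k → (if lookup M k then h k else ε) ∙ (if memB k cs then h k else ε)) (allFin m)
        ≈⟨ Sum-∙ _ _ (allFin m) ⟩
      SumMask M h ∙ Sum (λ k → if memB k cs then h k else ε) (allFin m)
        ≈⟨ ∙-congˡ (Sum-memB h cs cs!) ⟩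
      SumMask M h ∙ Sum h cs ∎
      where
      disjoint : ∀ k → lookup M k ≡ true → memB k cs ≡ false
      disjoint k Mk with memB k cs in k∈?
      ... | false = ≡.refl
      ... | true with ≡.trans (≡.sym Mk) (off k (memB-true k∈?))
      ...   | ()

    private
      masked : ∀ {a} {E : Set a} (h : E → A) (xs : List E) (M : Vec Bool (length xs)) → Fin (length xs) → A
      masked h xs M k = if lookup M k then h (L.lookup xs k) else ε

    Sum-select : ∀ {a} {E : Set a} (h : E → A) (xs : List E) (M : Vec Bool (length xs)) →
                 Sum h (select xs M) ≈ SumMask M (λ k → h (L.lookup xs k))
    Sum-select h []       []          = refl
    Sum-select h (x ∷ xs) (true ∷ M)  =
      trans (∙-congˡ (Sum-select h xs M)) (reflexive (≡.sym (Sum-allFin-suc (masked h (x ∷ xs) (true ∷ M)))))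
    Sum-select h (x ∷ xs) (false ∷ M) =
      trans (trans (sym (identityˡ _)) (∙-congˡ (Sum-select h xs M)))
            (reflexive (≡.sym (Sum-allFin-suc (masked h (x ∷ xs) (false ∷ M)))))

-- The edges of the projected network N are numbered 0 … m-1 by their
-- position in the list es.  A set of edges is a mask M : Vec Bool m; the
-- statistics that Defs computes on the selected sublist (degrees, winding
-- number, weight, successor) are expressed as sums over the mask.
module IndexedEdges {c ℓ} (R : CommutativeRing c ℓ) (N : ℕ) (es : List (Edge N (CommutativeRing.Carrier R))) where

  open import Defs
  open import Data.Bool using (Bool; true; false; if_then_else_)
  open import Data.Nat.Properties as ℕP using ()
  open import Data.Integer as ℤ using (ℤ)
  import Data.Integer.Properties as ℤP
  open import Data.Fin using (Fin; zero; suc)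
  open import Data.Fin.Properties using (_≟_; suc-injective)
  open import Data.List as L using ([]; _∷_; _++_; map; length; allFin)
  import Data.List.Properties as LP
  open import Data.Vec using (Vec; []; _∷_; lookup)
  open import Relation.Nullary using (yes; no; does)
  open import Relation.Binary.PropositionalEquality as ≡ using (_≡_)
  open import Data.Empty using (⊥-elim)
  open import Function using (_∘_)
  open Masks
  open NatSums using (length-filter≡Sum)

  open CommutativeRing R using (Carrier; _≈_; *-commutativeMonoid)
  open Net R N

  m : ℕ
  m = length es

  edgeAt : Fin m → E
  edgeAt = L.lookup es

  srcI tgtI : Fin m → Fin N
  srcI k = src (edgeAt k)
  tgtI k = tgt (edgeAt k)

  shiftI : Fin m → ℤ
  shiftI k = shift (edgeAt k)

  wtI : Fin m → Carrier
  wtI k = wt (edgeAt k)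

  map-indices : ∀ {b} {B : Set b} (h : E → B) → map h es ≡ map (h ∘ edgeAt) (allFin m)
  map-indices h = ≡.trans (≡.cong (map h) (≡.sym (LP.tabulate-lookup es)))
                    (≡.trans (LP.map-tabulate edgeAt h) (≡.sym (LP.map-tabulate (λ x → x) (h ∘ edgeAt))))

  subsets-select : ∀ (xs : List E) → subsets xs ≡ map (select xs) (masks (length xs))
  subsets-select []       = ≡.refl
  subsets-select (x ∷ xs) rewrite subsets-select xs =
    ≡.sym (≡.trans (LP.map-++ (select (x ∷ xs)) (map (true ∷_) (masks (length xs))) (map (false ∷_) (masks (length xs))))
                   (≡.cong₂ _++_ (≡.trans (≡.sym (LP.map-∘ (masks (length xs)))) (LP.map-∘ (masks (length xs))))
                                 (≡.sym (LP.map-∘ (masks (length xs))))))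

  module ℕΣ = MaskedSums ℕP.+-0-commutativeMonoid
  module ℤΣ = MaskedSums ℤP.+-0-commutativeMonoid
  module *Σ = MaskedSums *-commutativeMonoid

  δ : Fin N → Fin N → ℕ
  δ v u = if does (u ≟ v) then 1 else 0

  outdegM indegM : Vec Bool m → Fin N → ℕ
  outdegM M v = ℕΣ.SumMask M (δ v ∘ srcI)
  indegM  M v = ℕΣ.SumMask M (δ v ∘ tgtI)

  windM : Vec Bool m → ℤ
  windM M = ℤΣ.SumMask M shiftI

  wtM : Vec Bool m → Carrier
  wtM M = *Σ.SumMask M wtI

  size : Vec Bool m → ℕ
  size M = ℕΣ.SumMask M (λ _ → 1)

  outdeg-select : ∀ M v → outdeg (select es M) v ≡ outdegM M v
  outdeg-select M v = ≡.trans (length-filter≡Sum (λ e → src e ≟ v) (select es M)) (ℕΣ.Sum-select (δ v ∘ src) es M)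

  indeg-select : ∀ M v → indeg (select es M) v ≡ indegM M v
  indeg-select M v = ≡.trans (length-filter≡Sum (λ e → tgt e ≟ v) (select es M)) (ℕΣ.Sum-select (δ v ∘ tgt) es M)

  wind-select : ∀ M → wind (select es M) ≡ windM M
  wind-select M = ℤΣ.Sum-select shift es M

  weight-select : ∀ M → weight (select es M) ≈ wtM M
  weight-select M = *Σ.Sum-select wt es M

  next-select : ∀ (xs : List E) (M : Vec Bool (length xs)) v k → lookup M k ≡ true → src (L.lookup xs k) ≡ v →
                (∀ k′ → lookup M k′ ≡ true → src (L.lookup xs k′) ≡ v → k′ ≡ k) →
                next (select xs M) v ≡ tgt (L.lookup xs k)
  next-select (x ∷ xs) (true ∷ M) v zero _ x↦v _ with src x ≟ v
  ... | yes _    = ≡.refl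
  ... | no  x↦̸v = ⊥-elim (x↦̸v x↦v)
  next-select (x ∷ xs) (true ∷ M) v (suc k) Mk k↦v only with src x ≟ v
  ... | yes x↦v with only zero ≡.refl x↦v
  ...   | ()
  next-select (x ∷ xs) (true ∷ M) v (suc k) Mk k↦v only | no _ =
    next-select xs M v k Mk k↦v (λ k′ Mk′ k′↦v → suc-injective (only (suc k′) Mk′ k′↦v))
  next-select (x ∷ xs) (false ∷ M) v (suc k) Mk k↦v only =
    next-select xs M v k Mk k↦v (λ k′ Mk′ k′↦v → suc-injective (only (suc k′) Mk′ k′↦v))

-- Walks in the lifted network Ñ, encoded as sequences of edge indices.
module Walks {c ℓ} (R : CommutativeRing c ℓ) (N : ℕ) (es : List (Edge N (CommutativeRing.Carrier R))) where

  open import Defs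
  open import Data.Bool using (Bool; true; false; if_then_else_; _∧_)
  open import Data.Nat as ℕ using (zero; suc; _≤_; _<_; s≤s)
  import Data.Nat.Properties as ℕP
  open import Data.Integer as ℤ using (ℤ)
  import Data.Integer.Properties as ℤP
  open import Data.Fin using (Fin)
  open import Data.Fin.Properties using (_≟_)
  open import Data.List as L using ([]; _∷_; [_]; _++_; map; length; allFin; cartesianProductWith)
  open import Data.List.Membership.Propositional using (_∈_)
  open import Data.List.Membership.Propositional.Properties
    using (∈-lookup; ∈-allFin; ∈-++⁺ˡ; ∈-++⁺ʳ; ∈-++⁻; ∈-cartesianProductWith⁺; ∈-cartesianProductWith⁻)
  open import Data.List.Relation.Unary.Any using (here)
  import Data.List.Relation.Unary.All as All
  open import Data.List.Relation.Unary.AllPairs using ([]; _∷_)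
  open import Data.List.Relation.Unary.Unique.Propositional using (Unique)
  import Data.List.Relation.Unary.Unique.Propositional.Properties as UniqueP
  open import Data.Product using (Σ; _×_; _,_)
  open import Data.Sum using (inj₁; inj₂)
  open import Data.Unit using (⊤; tt)
  open import Relation.Nullary using (yes; no)
  open import Relation.Nullary.Decidable using (⌊_⌋)
  open import Relation.Binary.PropositionalEquality as ≡ using (_≡_)
  open import Data.Empty using (⊥-elim)
  open import Function using (_∘_)
  open BoolFacts using (true-witness; ∧-true⁻)
  open IndexedEdges R N es

  open CommutativeRing R
  open Net R N
  open RingSums R
  open import Relation.Binary.Reasoning.Setoid setoid

  walkValue : List (Fin m) → LVertex N → LVertex N → Carrier
  walkValue []       (a , i) (b , j) = if ⌊ a ≟ b ⌋ ∧ ⌊ i ℤ.≟ j ⌋ then 1# else 0#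
  walkValue (k ∷ ws) (a , i) y =
    if ⌊ srcI k ≟ a ⌋ then wtI k * walkValue ws (tgtI k , i ℤ.+ shiftI k) y else 0#

  seqsOfLength : ℕ → List (List (Fin m))
  seqsOfLength zero    = [] ∷ []
  seqsOfLength (suc k) = cartesianProductWith _∷_ (allFin m) (seqsOfLength k)

  seqsUpTo : ℕ → List (List (Fin m))
  seqsUpTo zero    = seqsOfLength 0
  seqsUpTo (suc K) = seqsUpTo K ++ seqsOfLength (suc K)

  W≈Sum-walkValue : ∀ k x y → W es k x y ≈ Sum (λ ws → walkValue ws x y) (seqsOfLength k)
  W≈Sum-walkValue zero    (a , i) (b , j) = sym (+-identityʳ _)
  W≈Sum-walkValue (suc k) (a , i) y = begin
    W es (suc k) (a , i) y
      ≡⟨ ≡.cong (sumK R) (map-indices firstStep) ⟩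
    Sum (firstStep ∘ edgeAt) (allFin m)
      ≈⟨ Sum-cong′ (allFin m) (λ k₀ → trans (expand k₀) (distribute (⌊ srcI k₀ ≟ a ⌋) k₀)) ⟩
    Sum (λ k₀ → Sum (λ ws → walkValue (k₀ ∷ ws) (a , i) y) (seqsOfLength k)) (allFin m)
      ≈⟨ Sum-cartesianProductWith (λ ws → walkValue ws (a , i) y) _∷_ (allFin m) (seqsOfLength k) ⟨
    Sum (λ ws → walkValue ws (a , i) y) (seqsOfLength (suc k)) ∎
    where
    firstStep : E → Carrier
    firstStep e = if ⌊ src e ≟ a ⌋ then wt e * W es k (tgt e , i ℤ.+ shift e) y else 0#
    rest : Fin m → Carrier
    rest k₀ = Sum (λ ws → walkValue ws (tgtI k₀ , i ℤ.+ shiftI k₀) y) (seqsOfLength k)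
    expand : ∀ k₀ → firstStep (edgeAt k₀) ≈ (if ⌊ srcI k₀ ≟ a ⌋ then wtI k₀ * rest k₀ else 0#)
    expand k₀ with srcI k₀ ≟ a
    ... | yes _ = *-congˡ (W≈Sum-walkValue k (tgtI k₀ , i ℤ.+ shiftI k₀) y)
    ... | no  _ = refl
    distribute : ∀ b k₀ → (if b then wtI k₀ * rest k₀ else 0#) ≈
                 Sum (λ ws → if b then wtI k₀ * walkValue ws (tgtI k₀ , i ℤ.+ shiftI k₀) y else 0#) (seqsOfLength k)
    distribute true  k₀ = Sum-*ˡ _ _ (seqsOfLength k)
    distribute false k₀ = sym (Sum-ε (seqsOfLength k) (λ _ _ → refl))

  pathSum≈Sum-walkValue : ∀ K x y → pathSum es K x y ≈ Sum (λ ws → walkValue ws x y) (seqsUpTo K)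
  pathSum≈Sum-walkValue zero    x y = W≈Sum-walkValue 0 x y
  pathSum≈Sum-walkValue (suc K) x y =
    trans (+-cong (pathSum≈Sum-walkValue K x y) (W≈Sum-walkValue (suc K) x y)) (sym (Sum-++ _ (seqsUpTo K) (seqsOfLength (suc K))))

  seqsOfLength-length : ∀ k ws → ws ∈ seqsOfLength k → length ws ≡ k
  seqsOfLength-length zero    .[] (here ≡.refl) = ≡.refl
  seqsOfLength-length (suc k) ws ws∈ with ∈-cartesianProductWith⁻ _∷_ (allFin m) (seqsOfLength k) ws∈
  ... | _ , ws′ , _ , ws′∈ , ≡.refl = ≡.cong suc (seqsOfLength-length k ws′ ws′∈)

  seqsOfLength-complete : ∀ ws → ws ∈ seqsOfLength (length ws)
  seqsOfLength-complete []       = here ≡.refl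
  seqsOfLength-complete (k ∷ ws) = ∈-cartesianProductWith⁺ _∷_ (∈-allFin k) (seqsOfLength-complete ws)

  seqsOfLength-unique : ∀ k → Unique (seqsOfLength k)
  seqsOfLength-unique zero    = All.[] ∷ []
  seqsOfLength-unique (suc k) =
    UniqueP.cartesianProductWith⁺ _∷_ (λ { ≡.refl → ≡.refl , ≡.refl }) (UniqueP.allFin⁺ m) (seqsOfLength-unique k)

  seqsUpTo-length : ∀ K ws → ws ∈ seqsUpTo K → length ws ≤ K
  seqsUpTo-length zero    ws ws∈ = ℕP.≤-reflexive (seqsOfLength-length 0 ws ws∈)
  seqsUpTo-length (suc K) ws ws∈ with ∈-++⁻ (seqsUpTo K) ws∈
  ... | inj₁ p = ℕP.m≤n⇒m≤1+n (seqsUpTo-length K ws p)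
  ... | inj₂ p = ℕP.≤-reflexive (seqsOfLength-length (suc K) ws p)

  seqsUpTo-complete : ∀ K ws → length ws ≤ K → ws ∈ seqsUpTo K
  seqsUpTo-complete zero    [] _ = here ≡.refl
  seqsUpTo-complete (suc K) ws len with ℕP.m≤n⇒m<n∨m≡n len
  ... | inj₁ lt = ∈-++⁺ˡ (seqsUpTo-complete K ws (ℕP.≤-pred lt))
  ... | inj₂ eq = ∈-++⁺ʳ (seqsUpTo K) (≡.subst (λ z → ws ∈ seqsOfLength z) eq (seqsOfLength-complete ws))

  seqsUpTo-unique : ∀ K → Unique (seqsUpTo K)
  seqsUpTo-unique zero    = seqsOfLength-unique 0
  seqsUpTo-unique (suc K) = UniqueP.++⁺ (seqsUpTo-unique K) (seqsOfLength-unique (suc K))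
    (λ (p , q) → ℕP.<-irrefl ≡.refl
       (ℕP.≤-trans (ℕP.≤-reflexive (≡.cong suc (≡.sym (seqsOfLength-length (suc K) _ q)))) (s≤s (seqsUpTo-length K _ p))))

  walkEnd : Fin N → List (Fin m) → Fin N
  walkEnd v []       = v
  walkEnd v (k ∷ ws) = walkEnd (tgtI k) ws

  walkShift : List (Fin m) → ℤ
  walkShift []       = ℤ.+ 0
  walkShift (k ∷ ws) = shiftI k ℤ.+ walkShift ws

  walkWeight : List (Fin m) → Carrier
  walkWeight []       = 1#
  walkWeight (k ∷ ws) = wtI k * walkWeight ws

  IsWalk : Fin N → List (Fin m) → Set
  IsWalk v []       = ⊤
  IsWalk v (k ∷ ws) = srcI k ≡ v × IsWalk (tgtI k) ws

  isWalk : Fin N → List (Fin m) → Bool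
  isWalk v []       = true
  isWalk v (k ∷ ws) = ⌊ srcI k ≟ v ⌋ ∧ isWalk (tgtI k) ws

  isWalk⁻ : ∀ v ws → isWalk v ws ≡ true → IsWalk v ws
  isWalk⁻ v []       _  = tt
  isWalk⁻ v (k ∷ ws) eq with srcI k ≟ v
  ... | yes k↦v = k↦v , isWalk⁻ (tgtI k) ws eq

  isWalk⁺ : ∀ v ws → IsWalk v ws → isWalk v ws ≡ true
  isWalk⁺ v []       _             = ≡.refl
  isWalk⁺ v (k ∷ ws) (k↦v , walk) with srcI k ≟ v
  ... | yes _    = isWalk⁺ (tgtI k) ws walk
  ... | no  k↦̸v = ⊥-elim (k↦̸v k↦v)

  isWalkFromTo : Fin N → ℤ → List (Fin m) → Fin N → ℤ → Bool
  isWalkFromTo v z ws b z′ = isWalk v ws ∧ (⌊ walkEnd v ws ≟ b ⌋ ∧ ⌊ z ℤ.+ walkShift ws ℤ.≟ z′ ⌋)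

  walkValue≈ : ∀ ws v z b z′ → walkValue ws (v , z) (b , z′) ≈ (if isWalkFromTo v z ws b z′ then walkWeight ws else 0#)
  walkValue≈ []       v z b z′ rewrite ℤP.+-identityʳ z = refl
  walkValue≈ (k ∷ ws) v z b z′ with srcI k ≟ v
  ... | no  _ = refl
  ... | yes _ rewrite ≡.sym (ℤP.+-assoc z (shiftI k) (walkShift ws)) =
    trans (*-congˡ (walkValue≈ ws (tgtI k) (z ℤ.+ shiftI k) b z′)) (scale (isWalkFromTo (tgtI k) (z ℤ.+ shiftI k) ws b z′))
    where
    scale : ∀ t → wtI k * (if t then walkWeight ws else 0#) ≈ (if t then wtI k * walkWeight ws else 0#)
    scale true  = refl
    scale false = zeroʳ _

  pathLength-subst : ∀ {x : LVertex N} {P : Set} (f : P → LVertex N) {p q : P} (eq : p ≡ q) (path : Path es x (f p)) →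
                     pathLength (≡.subst (Path es x ∘ f) eq path) ≡ pathLength path
  pathLength-subst f ≡.refl path = ≡.refl

  walk⇒path : ∀ v z ws → IsWalk v ws →
              Σ (Path es (v , z) (walkEnd v ws , z ℤ.+ walkShift ws)) (λ p → pathLength p ≡ length ws)
  walk⇒path v z [] _ =
    ≡.subst (λ w → Σ (Path es (v , z) (v , w)) (λ p → pathLength p ≡ 0)) (≡.sym (ℤP.+-identityʳ z)) ([] , ≡.refl)
  walk⇒path v z (k ∷ ws) (k↦v , walk) with walk⇒path (tgtI k) (z ℤ.+ shiftI k) ws walk
  ... | p , len = step (edgeAt k) (∈-lookup k) k↦v (≡.subst (Path es _ ∘ end) assoc p) ,
                  ≡.cong suc (≡.trans (pathLength-subst end assoc p) len)
    where
    end : ℤ → LVertex N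
    end w = walkEnd (tgtI k) ws , w
    assoc : z ℤ.+ shiftI k ℤ.+ walkShift ws ≡ z ℤ.+ (shiftI k ℤ.+ walkShift ws)
    assoc = ℤP.+-assoc z (shiftI k) (walkShift ws)

  walkFromTo⇒path : ∀ v z ws b z′ → isWalkFromTo v z ws b z′ ≡ true →
                    Σ (Path es (v , z) (b , z′)) (λ p → pathLength p ≡ length ws)
  walkFromTo⇒path v z ws b z′ ok with ∧-true⁻ {isWalk v ws} ok
  ... | walk , ends with ∧-true⁻ {⌊ walkEnd v ws ≟ b ⌋} ends
  ... | endV , endZ with true-witness (walkEnd v ws ≟ b) endV | true-witness (z ℤ.+ walkShift ws ℤ.≟ z′) endZ
  ... | ≡.refl | ≡.refl = walk⇒path v z ws (isWalk⁻ v ws walk)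

  W-vanish : ∀ v z b z′ B → (∀ (p : Path es (v , z) (b , z′)) → pathLength p ≤ B) →
             ∀ k → B < k → W es k (v , z) (b , z′) ≈ 0#
  W-vanish v z b z′ B bound k B<k =
    trans (W≈Sum-walkValue k (v , z) (b , z′)) (Sum-ε (seqsOfLength k) (λ ws ws∈ → trans (walkValue≈ ws v z b z′) (no-walk ws ws∈)))
    where
    no-walk : ∀ ws → ws ∈ seqsOfLength k → (if isWalkFromTo v z ws b z′ then walkWeight ws else 0#) ≈ 0#
    no-walk ws ws∈ with isWalkFromTo v z ws b z′ in ok
    ... | false = refl
    ... | true with walkFromTo⇒path v z ws b z′ ok
    ...   | p , len = ⊥-elim (ℕP.<-irrefl ≡.refl
                        (ℕP.<-≤-trans B<k (ℕP.≤-trans (ℕP.≤-reflexive (≡.sym (≡.trans len (seqsOfLength-length k ws ws∈)))) (bound p))))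

  walkEnd-++ : ∀ v xs ys → walkEnd v (xs ++ ys) ≡ walkEnd (walkEnd v xs) ys
  walkEnd-++ v []       ys = ≡.refl
  walkEnd-++ v (k ∷ xs) ys = walkEnd-++ (tgtI k) xs ys

  IsWalk-++⁻ : ∀ v xs ys → IsWalk v (xs ++ ys) → IsWalk v xs × IsWalk (walkEnd v xs) ys
  IsWalk-++⁻ v []       ys walk = tt , walk
  IsWalk-++⁻ v (k ∷ xs) ys (k↦v , walk) with IsWalk-++⁻ (tgtI k) xs ys walk
  ... | walk₁ , walk₂ = (k↦v , walk₁) , walk₂

  IsWalk-++⁺ : ∀ v xs ys → IsWalk v xs → IsWalk (walkEnd v xs) ys → IsWalk v (xs ++ ys)
  IsWalk-++⁺ v []       ys _               walk₂ = walk₂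
  IsWalk-++⁺ v (k ∷ xs) ys (k↦v , walk₁) walk₂ = k↦v , IsWalk-++⁺ (tgtI k) xs ys walk₁ walk₂

  walkShift-++ : ∀ xs ys → walkShift (xs ++ ys) ≡ walkShift xs ℤ.+ walkShift ys
  walkShift-++ []       ys = ≡.sym (ℤP.+-identityˡ _)
  walkShift-++ (k ∷ xs) ys = ≡.trans (≡.cong (λ w → shiftI k ℤ.+ w) (walkShift-++ xs ys)) (≡.sym (ℤP.+-assoc (shiftI k) _ _))

  walkWeight-++ : ∀ xs ys → walkWeight (xs ++ ys) ≈ walkWeight xs * walkWeight ys
  walkWeight-++ []       ys = sym (*-identityˡ _)
  walkWeight-++ (k ∷ xs) ys = trans (*-congˡ (walkWeight-++ xs ys)) (sym (*-assoc _ _ _))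

  sources-targets : ∀ v ds → IsWalk v ds → v ∷ map tgtI ds ≡ map srcI ds ++ [ walkEnd v ds ]
  sources-targets v []       _             = ≡.refl
  sources-targets v (k ∷ ds) (k↦v , walk) = ≡.cong₂ _∷_ (≡.sym k↦v) (sources-targets (tgtI k) ds walk)

module MaskMulticycles {c ℓ} (R : CommutativeRing c ℓ) (N : ℕ) (es : List (Edge N (CommutativeRing.Carrier R))) where

  open import Defs
  open import Data.Bool using (Bool; true; false; if_then_else_; _∧_)
  import Data.Bool as Bool
  open import Data.Nat as ℕ using (_+_; _≤_; s≤s; z≤n)
  import Data.Nat.Properties as ℕP
  import Data.Integer as ℤ
  open import Data.Fin using (Fin)
  open import Data.Fin.Properties using (_≟_; any?)
  open import Data.List as L using ([]; _∷_; [_]; _++_; map; allFin)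
  open import Data.List.Membership.Propositional using (_∈_)
  open import Data.List.Membership.Propositional.Properties using (∈-allFin; ∈-map⁻)
  open import Data.List.Relation.Unary.Any using (here)
  open import Data.List.Relation.Unary.Unique.Propositional using (Unique)
  import Data.List.Relation.Unary.Unique.Propositional.Properties as UniqueP
  open import Data.Vec using (Vec; lookup)
  open import Data.Product using (_×_; _,_; proj₁; proj₂; ∃)
  open import Relation.Nullary using (yes; no; _×-dec_)
  open import Relation.Nullary.Decidable using (⌊_⌋)
  open import Relation.Binary.PropositionalEquality as ≡ using (_≡_; _≢_)
  open import Data.Empty using (⊥-elim)
  open import Data.Unit using (tt)
  open import Function using (_∘_)
  open BoolFacts
  open Masks
  open NatSums
  open IndexedEdges R N es
  open Walks R N es

  open CommutativeRing R using (Carrier; _≈_; _*_; trans; *-congˡ)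
  open Net R N
  import Data.List.Membership.DecPropositional
  module DecMembership {n} = Data.List.Membership.DecPropositional (_≟_ {n})

  δ-refl : ∀ v → δ v v ≡ 1
  δ-refl v with v ≟ v
  ... | yes _   = ≡.refl
  ... | no  v≢v = ⊥-elim (v≢v ≡.refl)

  selected-out : ∀ M k → lookup M k ≡ true → 1 ≤ outdegM M (srcI k)
  selected-out M k Mk = ℕP.≤-trans (ℕP.≤-reflexive (≡.sym term)) (term≤Sum _ k)
    where
    term : (if lookup M k then δ (srcI k) (srcI k) else 0) ≡ 1
    term rewrite Mk = δ-refl (srcI k)

  selected-in : ∀ M k → lookup M k ≡ true → 1 ≤ indegM M (tgtI k)
  selected-in M k Mk = ℕP.≤-trans (ℕP.≤-reflexive (≡.sym term)) (term≤Sum _ k)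
    where
    term : (if lookup M k then δ (tgtI k) (tgtI k) else 0) ≡ 1
    term rewrite Mk = δ-refl (tgtI k)

  private
    two-selected : ∀ M (end : Fin m → Fin N) k k′ → lookup M k ≡ true → lookup M k′ ≡ true → end k ≡ end k′ → k ≢ k′ →
                   2 ≤ Sum (λ j → if lookup M j then δ (end k) (end j) else 0) (allFin m)
    two-selected M end k k′ Mk Mk′ same k≢k′ =
      ℕP.≤-trans (ℕP.≤-reflexive (≡.cong₂ _+_ (≡.sym (term k Mk ≡.refl)) (≡.sym (term k′ Mk′ same))))
                 (two-terms≤Sum _ k k′ k≢k′)
      where
      term : ∀ j → lookup M j ≡ true → end k ≡ end j → (if lookup M j then δ (end k) (end j) else 0) ≡ 1
      term j Mj eq rewrite Mj | eq = δ-refl (end j)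

  IsMulticycle : Vec Bool m → Set
  IsMulticycle M = ∀ v → outdegM M v ≤ 1 × outdegM M v ≡ indegM M v

  source-unique : ∀ M → IsMulticycle M → ∀ k k′ → lookup M k ≡ true → lookup M k′ ≡ true → srcI k ≡ srcI k′ → k ≡ k′
  source-unique M mc k k′ Mk Mk′ same with k ≟ k′
  ... | yes k≡k′ = k≡k′
  ... | no  k≢k′ = ⊥-elim (ℕP.<-irrefl ≡.refl (ℕP.≤-trans (two-selected M srcI k k′ Mk Mk′ same k≢k′) (proj₁ (mc (srcI k)))))

  target-unique : ∀ M → IsMulticycle M → ∀ k k′ → lookup M k ≡ true → lookup M k′ ≡ true → tgtI k ≡ tgtI k′ → k ≡ k′
  target-unique M mc k k′ Mk Mk′ same with k ≟ k′
  ... | yes k≡k′ = k≡k′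
  ... | no  k≢k′ = ⊥-elim (ℕP.<-irrefl ≡.refl (ℕP.≤-trans (two-selected M tgtI k k′ Mk Mk′ same k≢k′)
                     (ℕP.≤-trans (ℕP.≤-reflexive (≡.sym (proj₂ (mc (tgtI k))))) (proj₁ (mc (tgtI k))))))

  leaving-edge : ∀ M v → 1 ≤ outdegM M v → ∃ λ k → lookup M k ≡ true × srcI k ≡ v
  leaving-edge M v pos with any? (λ k → (lookup M k Bool.≟ true) ×-dec (srcI k ≟ v))
  ... | yes found = found
  ... | no  none  = ⊥-elim (ℕP.<-irrefl ≡.refl (ℕP.≤-trans pos (ℕP.≤-reflexive (Sum-ε (allFin m) (λ k _ → no-term k)))))
    where
    no-term : ∀ k → (if lookup M k then δ v (srcI k) else 0) ≡ 0
    no-term k with lookup M k in Mk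
    ... | false = ≡.refl
    ... | true with srcI k ≟ v
    ...   | yes k↦v = ⊥-elim (none (k , Mk , k↦v))
    ...   | no  _   = ≡.refl

  succM : Vec Bool m → Fin N → Fin N
  succM M = next (select es M)

  succM-edge : ∀ M → IsMulticycle M → ∀ k → lookup M k ≡ true → succM M (srcI k) ≡ tgtI k
  succM-edge M mc k Mk = next-select es M (srcI k) k Mk ≡.refl (λ k′ Mk′ same → source-unique M mc k′ k Mk′ Mk same)

  succM-closed : ∀ M → IsMulticycle M → ∀ v → 1 ≤ outdegM M v → 1 ≤ outdegM M (succM M v)
  succM-closed M mc v pos with leaving-edge M v pos
  ... | k , Mk , ≡.refl rewrite succM-edge M mc k Mk =
    ℕP.≤-trans (selected-in M k Mk) (ℕP.≤-reflexive (≡.sym (proj₂ (mc (tgtI k)))))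

  succM-injective : ∀ M → IsMulticycle M → ∀ u w → 1 ≤ outdegM M u → 1 ≤ outdegM M w → succM M u ≡ succM M w → u ≡ w
  succM-injective M mc u w pu pw eq with leaving-edge M u pu | leaving-edge M w pw
  ... | k , Mk , ≡.refl | k′ , Mk′ , ≡.refl rewrite succM-edge M mc k Mk | succM-edge M mc k′ Mk′ =
    ≡.cong srcI (target-unique M mc k k′ Mk Mk′ eq)

  isMulticycleM : Vec Bool m → Bool
  isMulticycleM M = isMulticycle (select es M)

  isMulticycleM⁻ : ∀ M → isMulticycleM M ≡ true → IsMulticycle M
  isMulticycleM⁻ M ok v with ∧-true⁻ {⌊ outdeg (select es M) v ℕ.≤? 1 ⌋} (all-true⁻ _ (allFin N) ok v (∈-allFin v))
  ... | le , eq = ≡.subst (_≤ 1) (outdeg-select M v) (true-witness (outdeg (select es M) v ℕ.≤? 1) le) ,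
                  ≡.trans (≡.sym (outdeg-select M v))
                    (≡.trans (true-witness (outdeg (select es M) v ℕ.≟ indeg (select es M) v) eq) (indeg-select M v))

  isMulticycleM⁺ : ∀ M → IsMulticycle M → isMulticycleM M ≡ true
  isMulticycleM⁺ M mc = all-true⁺ _ (allFin N) λ v _ →
    ≡.cong₂ _∧_ (witness-true (outdeg (select es M) v ℕ.≤? 1) (≡.subst (_≤ 1) (≡.sym (outdeg-select M v)) (proj₁ (mc v))))
                (witness-true (outdeg (select es M) v ℕ.≟ indeg (select es M) v)
                          (≡.trans (outdeg-select M v) (≡.trans (proj₂ (mc v)) (≡.sym (indeg-select M v)))))

  data Loop (c : Fin N) : Fin N → List (Fin m) → Set where
    last : ∀ {v k}    → srcI k ≡ v → tgtI k ≡ c → Loop c v (k ∷ [])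
    more : ∀ {v k ds} → srcI k ≡ v → tgtI k ≢ c → Loop c (tgtI k) ds → Loop c v (k ∷ ds)

  Loop⇒walk : ∀ {c v ds} → Loop c v ds → IsWalk v ds × walkEnd v ds ≡ c
  Loop⇒walk (last k↦v k↣c) = (k↦v , tt) , k↣c
  Loop⇒walk (more k↦v _ loop) with Loop⇒walk loop
  ... | walk , end = (k↦v , walk) , end

  Loop-start : ∀ {c v ds} → Loop c v ds → v ∈ map srcI ds
  Loop-start (last k↦v _)   = here (≡.sym k↦v)
  Loop-start (more k↦v _ _) = here (≡.sym k↦v)

  Loop-nonempty : ∀ {c v ds} → Loop c v ds → 1 ≤ L.length ds
  Loop-nonempty (last _ _)   = s≤s z≤n
  Loop-nonempty (more _ _ _) = s≤s z≤n

  SimpleCycle : Fin N → List (Fin m) → Set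
  SimpleCycle c cs = Loop c c cs × Unique (map srcI cs)

  SimpleCycle-unique : ∀ {c cs} → SimpleCycle c cs → Unique cs
  SimpleCycle-unique (_ , srcs!) = UniqueP.map⁻ srcs!

  count-targets : ∀ {c cs} → SimpleCycle c cs → ∀ v → count v (map tgtI cs) ≡ count v (map srcI cs)
  count-targets {c} {cs} (loop , _) v with Loop⇒walk loop
  ... | walk , end = ℕP.+-cancelˡ-≡ (δ v c) _ _ (begin
    δ v c + count v (map tgtI cs)              ≡⟨ ≡.cong (count v) (sources-targets c cs walk) ⟩
    count v (map srcI cs ++ [ walkEnd c cs ])   ≡⟨ Sum-++ (δ v) (map srcI cs) [ walkEnd c cs ] ⟩
    count v (map srcI cs) + (δ v (walkEnd c cs) + 0) ≡⟨ ≡.cong (λ u → count v (map srcI cs) + u) (ℕP.+-identityʳ _) ⟩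
    count v (map srcI cs) + δ v (walkEnd c cs)  ≡⟨ ≡.cong (λ u → count v (map srcI cs) + δ v u) end ⟩
    count v (map srcI cs) + δ v c              ≡⟨ ℕP.+-comm _ (δ v c) ⟩
    δ v c + count v (map srcI cs)              ∎)
    where
    open ≡.≡-Reasoning

  edge-source : ∀ v cs → v ∈ map srcI cs → ∃ λ k → k ∈ cs × srcI k ≡ v
  edge-source v cs v∈ with ∈-map⁻ srcI v∈
  ... | k , k∈ , eq = k , k∈ , ≡.sym eq

  DisjointFrom : Vec Bool m → List (Fin m) → Set
  DisjointFrom M cs = ∀ k → k ∈ cs → outdegM M (srcI k) ≡ 0

  DisjointFrom⇒unselected : ∀ M cs → DisjointFrom M cs → ∀ k → k ∈ cs → lookup M k ≡ false
  DisjointFrom⇒unselected M cs disj k k∈ with lookup M k in Mk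
  ... | false = ≡.refl
  ... | true with selected-out M k Mk
  ...   | pos rewrite disj k k∈ with pos
  ...     | ()

  module _ (M : Vec Bool m) (cs : List (Fin m)) (cs! : Unique cs) (off : ∀ k → k ∈ cs → lookup M k ≡ false) where

    outdeg-setBits : ∀ v → outdegM (setBits cs M) v ≡ outdegM M v + count v (map srcI cs)
    outdeg-setBits v = ≡.trans (ℕΣ.SumMask-setBits (δ v ∘ srcI) cs M cs! off)
                               (≡.cong (outdegM M v +_) (≡.sym (Sum-map (δ v) srcI cs)))

    indeg-setBits : ∀ v → indegM (setBits cs M) v ≡ indegM M v + count v (map tgtI cs)
    indeg-setBits v = ≡.trans (ℕΣ.SumMask-setBits (δ v ∘ tgtI) cs M cs! off)
                              (≡.cong (indegM M v +_) (≡.sym (Sum-map (δ v) tgtI cs)))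

    windM-setBits : windM (setBits cs M) ≡ windM M ℤ.+ walkShift cs
    windM-setBits = ≡.trans (ℤΣ.SumMask-setBits shiftI cs M cs! off) (≡.cong (λ w → windM M ℤ.+ w) (shifts cs))
      where
      shifts : ∀ cs → ℤΣ.Sum shiftI cs ≡ walkShift cs
      shifts []       = ≡.refl
      shifts (k ∷ cs) = ≡.cong (λ w → shiftI k ℤ.+ w) (shifts cs)

    wtM-setBits : wtM (setBits cs M) ≈ wtM M * walkWeight cs
    wtM-setBits = trans (*Σ.SumMask-setBits wtI cs M cs! off) (*-congˡ (weights cs))
      where
      weights : ∀ cs → *Σ.Sum wtI cs ≈ walkWeight cs
      weights []       = CommutativeRing.refl R
      weights (k ∷ cs) = *-congˡ (weights cs)

  IsMulticycle-setBits : ∀ M c cs → IsMulticycle M → SimpleCycle c cs → DisjointFrom M cs → IsMulticycle (setBits cs M)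
  IsMulticycle-setBits M c cs mc sc disj v with DecMembership._∈?_ v (map srcI cs)
  ... | yes v∈ with edge-source v cs v∈
  ...   | k , k∈ , ≡.refl = on-cycle
    where
    cs! = SimpleCycle-unique sc
    off = DisjointFrom⇒unselected M cs disj
    on-cycle : outdegM (setBits cs M) (srcI k) ≤ 1 × outdegM (setBits cs M) (srcI k) ≡ indegM (setBits cs M) (srcI k)
    on-cycle rewrite outdeg-setBits M cs cs! off (srcI k) | indeg-setBits M cs cs! off (srcI k)
                   | count-targets sc (srcI k) | ≡.sym (proj₂ (mc (srcI k))) | disj k k∈ =
      count-unique (srcI k) (map srcI cs) (proj₂ sc) , ≡.refl
  IsMulticycle-setBits M c cs mc sc disj v | no v∉ = off-cycle
    where
    cs! = SimpleCycle-unique sc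
    off = DisjointFrom⇒unselected M cs disj
    off-cycle : outdegM (setBits cs M) v ≤ 1 × outdegM (setBits cs M) v ≡ indegM (setBits cs M) v
    off-cycle rewrite outdeg-setBits M cs cs! off v | indeg-setBits M cs cs! off v
                    | count-targets sc v | count-∉ v (map srcI cs) v∉ | ℕP.+-identityʳ (outdegM M v) | ℕP.+-identityʳ (indegM M v) =
      proj₁ (mc v) , proj₂ (mc v)

module CycleExtraction {c ℓ} (R : CommutativeRing c ℓ) (N : ℕ) (es : List (Edge N (CommutativeRing.Carrier R))) where

  open import Defs
  open import Data.Bool using (Bool; true; false; if_then_else_; _∧_)
  open import Data.Nat as ℕ using (zero; suc; _+_; _∸_; _≤_; _<_; s≤s; z≤n)
  import Data.Nat.Properties as ℕP
  open import Data.Fin using (Fin; toℕ)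
  open import Data.Fin.Properties using (_≟_; pigeonhole; toℕ<n)
  open import Data.Maybe using (Maybe; just; nothing)
  open import Data.List as L using ([]; _∷_; map; length; allFin; applyUpTo; findᵇ)
  import Data.List.Properties as LP
  open import Data.List.Membership.Propositional using (_∈_)
  open import Data.List.Membership.Propositional.Properties using (∈-allFin)
  open import Data.List.Relation.Unary.Any using (here; there)
  open import Data.List.Relation.Unary.Unique.Propositional using (Unique)
  import Data.List.Relation.Unary.Unique.Propositional.Properties as UniqueP
  open import Data.Vec using (Vec; lookup)
  open import Data.Product using (_×_; _,_; proj₁; proj₂; ∃)
  open import Relation.Nullary using (¬_; yes; no; _×-dec_)
  open import Relation.Nullary.Decidable using (⌊_⌋)
  open import Relation.Binary.PropositionalEquality as ≡ using (_≡_; _≢_)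
  open import Data.Empty using (⊥-elim)
  open import Function using (_∘_)
  open NatSums using (unique-length)
  open LeastWitness using (least)
  open IndexedEdges R N es
  open MaskMulticycles R N es

  open Net R N using (iter)

  findᵇ-unique : ∀ {a} {A : Set a} (p : A → Bool) xs x → x ∈ xs → p x ≡ true →
                 (∀ y → p y ≡ true → y ≡ x) → findᵇ p xs ≡ just x
  findᵇ-unique p (y ∷ xs) x x∈ px only with p y in py
  ... | true = ≡.cong just (only y py)
  findᵇ-unique p (y ∷ xs) x (here ≡.refl) px only | false with ≡.trans (≡.sym px) py
  ... | ()
  findᵇ-unique p (y ∷ xs) x (there x∈) px only | false = findᵇ-unique p xs x x∈ px only

  leavingEdgeOf : Vec Bool m → Fin N → Maybe (Fin m)
  leavingEdgeOf M u = findᵇ (λ k → lookup M k ∧ ⌊ srcI k ≟ u ⌋) (allFin m)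

  leavingEdgeOf-edge : ∀ M → IsMulticycle M → ∀ k → lookup M k ≡ true → leavingEdgeOf M (srcI k) ≡ just k
  leavingEdgeOf-edge M mc k Mk = findᵇ-unique _ (allFin m) k (∈-allFin k) (leaves k Mk ≡.refl) only
    where
    leaves : ∀ k′ → lookup M k′ ≡ true → srcI k′ ≡ srcI k → (lookup M k′ ∧ ⌊ srcI k′ ≟ srcI k ⌋) ≡ true
    leaves k′ Mk′ same rewrite Mk′ | same with srcI k ≟ srcI k
    ... | yes _ = ≡.refl
    ... | no  ≢ = ⊥-elim (≢ ≡.refl)
    only : ∀ k′ → (lookup M k′ ∧ ⌊ srcI k′ ≟ srcI k ⌋) ≡ true → k′ ≡ k
    only k′ ok with lookup M k′ in Mk′ | srcI k′ ≟ srcI k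
    ... | true | yes same = source-unique M mc k′ k Mk′ Mk same

  follow : Vec Bool m → Fin N → ℕ → Fin N → List (Fin m)
  follow M c zero    u = []
  follow M c (suc f) u with leavingEdgeOf M u
  ... | nothing = []
  ... | just k  = k ∷ (if ⌊ tgtI k ≟ c ⌋ then [] else follow M c f (tgtI k))

  -- the cycle of M through c: at most N steps suffice
  cycleThrough : Vec Bool m → Fin N → List (Fin m)
  cycleThrough M c = follow M c N c

  follow-loop : ∀ M → IsMulticycle M → ∀ {c u ds} → Loop c u ds → (∀ k → k ∈ ds → lookup M k ≡ true) →
                ∀ f → length ds ≤ f → follow M c f u ≡ ds
  follow-loop M mc {c} (last {k = k} ≡.refl k↣c) inM (suc f) _
    rewrite leavingEdgeOf-edge M mc k (inM k (here ≡.refl)) with tgtI k ≟ c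
  ... | yes _    = ≡.refl
  ... | no  k↣̸c = ⊥-elim (k↣̸c k↣c)
  follow-loop M mc {c} (more {k = k} ≡.refl k↣̸c loop) inM (suc f) (s≤s len)
    rewrite leavingEdgeOf-edge M mc k (inM k (here ≡.refl)) with tgtI k ≟ c
  ... | yes k↣c = ⊥-elim (k↣̸c k↣c)
  ... | no  _   = ≡.cong (k ∷_) (follow-loop M mc loop (λ k′ p → inM k′ (there p)) f len)

  cycleThrough-unique : ∀ M → IsMulticycle M → ∀ c cs → SimpleCycle c cs → (∀ k → k ∈ cs → lookup M k ≡ true) →
                        cycleThrough M c ≡ cs
  cycleThrough-unique M mc c cs (loop , srcs!) inM =
    follow-loop M mc loop inM N (≡.subst (_≤ N) (LP.length-map srcI cs) (unique-length (map srcI cs) srcs!))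

  applyUpTo-cong : ∀ {a} {A : Set a} {f g : ℕ → A} → (∀ i → f i ≡ g i) → ∀ r → applyUpTo f r ≡ applyUpTo g r
  applyUpTo-cong eq zero    = ≡.refl
  applyUpTo-cong eq (suc r) = ≡.cong₂ _∷_ (eq 0) (applyUpTo-cong (eq ∘ suc) r)

  -- Existence: the orbit u q = succ^q c of a covered vertex returns to c
  -- (succ is injective on covered vertices and N is finite); up to the
  -- first return time L its edges form a simple cycle.
  module Orbit (M : Vec Bool m) (mc : IsMulticycle M) (c : Fin N) (c-covered : 1 ≤ outdegM M c) where

    u : ℕ → Fin N
    u q = iter q (succM M) c

    covered : ∀ q → 1 ≤ outdegM M (u q)
    covered zero    = c-covered
    covered (suc q) = succM-closed M mc (u q) (covered q)

    cancel : ∀ a t → u a ≡ u (a + t) → c ≡ u t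
    cancel zero    t eq = eq
    cancel (suc a) t eq = cancel a t (succM-injective M mc (u a) (u (a + t)) (covered a) (covered (a + t)) eq)

    Returns : ℕ → Set
    Returns q = 1 ≤ q × u q ≡ c

    returns : ∃ λ t → t ≤ N × Returns t
    returns with pigeonhole (ℕP.n<1+n N) (λ (i : Fin (suc N)) → u (toℕ i))
    ... | i , j , i<j , eq =
      toℕ j ∸ toℕ i , ℕP.≤-trans (ℕP.m∸n≤m (toℕ j) (toℕ i)) (ℕP.≤-pred (toℕ<n j)) , ℕP.m<n⇒0<n∸m i<j ,
      ≡.sym (cancel (toℕ i) (toℕ j ∸ toℕ i) (≡.trans eq (≡.cong u (≡.sym (ℕP.m+[n∸m]≡n (ℕP.<⇒≤ i<j))))))

    firstReturn = least Returns (λ q → (1 ℕ.≤? q) ×-dec (u q ≟ c)) (proj₁ returns) (proj₂ (proj₂ returns))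

    L : ℕ
    L = proj₁ firstReturn

    L≥1 : 1 ≤ L
    L≥1 = proj₁ (proj₁ (proj₂ (proj₂ firstReturn)))

    u[L]≡c : u L ≡ c
    u[L]≡c = proj₂ (proj₁ (proj₂ (proj₂ firstReturn)))

    no-earlier-return : ∀ q → q < L → ¬ Returns q
    no-earlier-return = proj₂ (proj₂ (proj₂ firstReturn))

    distinct : ∀ {a b} → a < b → b < L → u a ≢ u b
    distinct {a} {b} a<b b<L eq = no-earlier-return (b ∸ a) (ℕP.≤-<-trans (ℕP.m∸n≤m b a) b<L)
      (ℕP.m<n⇒0<n∸m a<b , ≡.sym (cancel a (b ∸ a) (≡.trans eq (≡.cong u (≡.sym (ℕP.m+[n∸m]≡n (ℕP.<⇒≤ a<b)))))))

    orbitEdge : ℕ → Fin m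
    orbitEdge q = proj₁ (leaving-edge M (u q) (covered q))

    orbitEdge-selected : ∀ q → lookup M (orbitEdge q) ≡ true
    orbitEdge-selected q = proj₁ (proj₂ (leaving-edge M (u q) (covered q)))

    orbitEdge-src : ∀ q → srcI (orbitEdge q) ≡ u q
    orbitEdge-src q = proj₂ (proj₂ (leaving-edge M (u q) (covered q)))

    orbitEdge-tgt : ∀ q → tgtI (orbitEdge q) ≡ u (suc q)
    orbitEdge-tgt q = ≡.trans (≡.sym (succM-edge M mc (orbitEdge q) (orbitEdge-selected q))) (≡.cong (succM M) (orbitEdge-src q))

    segment : ℕ → ℕ → List (Fin m)
    segment q zero    = []
    segment q (suc r) = orbitEdge q ∷ segment (suc q) r

    segment-loop : ∀ r q → q + suc r ≡ L → Loop c (u q) (segment q (suc r))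
    segment-loop zero    q eq = last (orbitEdge-src q) (≡.trans (orbitEdge-tgt q) (≡.trans (≡.cong u (≡.trans (ℕP.+-comm 1 q) eq)) u[L]≡c))
    segment-loop (suc r) q eq =
      more (orbitEdge-src q) (λ t≡c → no-earlier-return (suc q) 1+q<L (s≤s z≤n , ≡.trans (≡.sym (orbitEdge-tgt q)) t≡c))
           (≡.subst (λ w → Loop c w (segment (suc q) (suc r))) (≡.sym (orbitEdge-tgt q)) (segment-loop r (suc q) eq′))
      where
      eq′ : suc q + suc r ≡ L
      eq′ = ≡.trans (≡.sym (ℕP.+-suc q (suc r))) eq
      1+q<L : suc q < L
      1+q<L = ℕP.≤-trans (s≤s (s≤s (ℕP.m≤m+n q r))) (ℕP.≤-reflexive (≡.trans (≡.cong suc (≡.sym (ℕP.+-suc q r))) eq′))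

    segment-sources : ∀ r q → map srcI (segment q r) ≡ applyUpTo (λ i → u (q + i)) r
    segment-sources zero    q = ≡.refl
    segment-sources (suc r) q = ≡.cong₂ _∷_ (≡.trans (orbitEdge-src q) (≡.cong u (≡.sym (ℕP.+-identityʳ q))))
      (≡.trans (segment-sources r (suc q)) (applyUpTo-cong (λ i → ≡.cong u (≡.sym (ℕP.+-suc q i))) r))

    segment-selected : ∀ r q k → k ∈ segment q r → lookup M k ≡ true
    segment-selected (suc r) q k (here ≡.refl) = orbitEdge-selected q
    segment-selected (suc r) q k (there k∈)    = segment-selected r (suc q) k k∈

    cycle : List (Fin m)
    cycle = segment 0 L

    cycle-simple : SimpleCycle c cycle
    cycle-simple = loop L≥1 ≡.refl ,
      ≡.subst Unique (≡.sym (segment-sources L 0)) (UniqueP.applyUpTo⁺₁ u L distinct)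
      where
      loop : ∀ {L′} → 1 ≤ L′ → L′ ≡ L → Loop c c (segment 0 L′)
      loop {suc r} _ eq = segment-loop r 0 eq

  cycleThrough-spec : ∀ M → IsMulticycle M → ∀ c → 1 ≤ outdegM M c →
                      SimpleCycle c (cycleThrough M c) × (∀ k → k ∈ cycleThrough M c → lookup M k ≡ true)
  cycleThrough-spec M mc c covered =
    ≡.subst (λ cs → SimpleCycle c cs × (∀ k → k ∈ cs → lookup M k ≡ true)) (≡.sym is-cycle) (cycle-simple , segment-selected L 0)
    where
    open Orbit M mc c covered
    is-cycle : cycleThrough M c ≡ cycle
    is-cycle = cycleThrough-unique M mc c cycle cycle-simple (segment-selected L 0)

module RemoveCycle {c ℓ} (R : CommutativeRing c ℓ) (N : ℕ) (es : List (Edge N (CommutativeRing.Carrier R)))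
  where

  open import Data.Bool using (Bool; true; false)
  open import Data.Nat as ℕ using (zero; suc; _+_; _≤_; _<_; s≤s)
  import Data.Integer as ℤ
  import Data.Nat.Properties as ℕP
  open import Data.Fin using (Fin)
  open import Data.List using ([]; _∷_; map; length)
  open import Data.List.Membership.Propositional using (_∈_)
  open import Data.List.Membership.Propositional.Properties using (∈-map⁺)
  open import Data.Vec using (Vec; lookup)
  open import Data.Product using (_,_; proj₁; proj₂)
  open import Relation.Binary.PropositionalEquality as ≡ using (_≡_)
  open Masks
  open NatSums using (count; count-∈)
  open IndexedEdges R N es
  open Walks R N es using (walkShift)
  open MaskMulticycles R N es

  module Removal (M : Vec Bool m) (c : Fin N) (cs : List (Fin m)) (mc : IsMulticycle M) (sc : SimpleCycle c cs)
           (inM : ∀ k → k ∈ cs → lookup M k ≡ true) where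

    M′ : Vec Bool m
    M′ = clearBits cs M

    M′+cs≡M : setBits cs M′ ≡ M
    M′+cs≡M = setBits-clearBits cs M inM

    M′-off : ∀ k → k ∈ cs → lookup M′ k ≡ false
    M′-off = clearBits-∈ M cs

    outdeg-split : ∀ v → outdegM M v ≡ outdegM M′ v + count v (map srcI cs)
    outdeg-split v = ≡.subst (λ X → outdegM X v ≡ outdegM M′ v + count v (map srcI cs)) M′+cs≡M
                             (outdeg-setBits M′ cs (SimpleCycle-unique sc) M′-off v)

    indeg-split : ∀ v → indegM M v ≡ indegM M′ v + count v (map tgtI cs)
    indeg-split v = ≡.subst (λ X → indegM X v ≡ indegM M′ v + count v (map tgtI cs)) M′+cs≡M
                            (indeg-setBits M′ cs (SimpleCycle-unique sc) M′-off v)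

    windM-split : windM M ≡ windM M′ ℤ.+ walkShift cs
    windM-split = ≡.subst (λ X → windM X ≡ windM M′ ℤ.+ walkShift cs) M′+cs≡M (windM-setBits M′ cs (SimpleCycle-unique sc) M′-off)

    size-split : size M ≡ size M′ + length cs
    size-split = ≡.subst (λ X → size X ≡ size M′ + length cs) M′+cs≡M
      (≡.trans (ℕΣ.SumMask-setBits (λ _ → 1) cs M′ (SimpleCycle-unique sc) M′-off) (≡.cong (size M′ +_) (ones cs)))
      where
      ones : ∀ cs → ℕΣ.Sum (λ _ → 1) cs ≡ length cs
      ones []       = ≡.refl
      ones (_ ∷ cs) = ≡.cong suc (ones cs)

    size-decreases : size M′ < size M
    size-decreases = ℕP.≤-trans (ℕP.≤-trans (ℕP.≤-reflexive (ℕP.+-comm 1 (size M′))) (ℕP.+-monoʳ-≤ (size M′) (Loop-nonempty (proj₁ sc))))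
                                (ℕP.≤-reflexive (≡.sym size-split))

    private
      sum≤1 : ∀ a b → a + b ≤ 1 → 1 ≤ b → a ≡ 0
      sum≤1 zero    _       _        _ = ≡.refl
      sum≤1 (suc a) (suc b) (s≤s le) _ rewrite ℕP.+-suc a b with le
      ... | ()

    -- cs avoids the vertices covered by M′, since M has out-degree ≤ 1
    M′-disjoint : DisjointFrom M′ cs
    M′-disjoint k k∈ = sum≤1 _ _ (≡.subst (_≤ 1) (outdeg-split (srcI k)) (proj₁ (mc (srcI k)))) (count-∈ (srcI k) _ (∈-map⁺ srcI k∈))

    M′-multicycle : IsMulticycle M′
    M′-multicycle v =
      ℕP.≤-trans (ℕP.m≤m+n _ _) (≡.subst (_≤ 1) (outdeg-split v) (proj₁ (mc v))) ,
      ℕP.+-cancelʳ-≡ (count v (map srcI cs)) _ _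
        (≡.trans (≡.sym (outdeg-split v)) (≡.trans (proj₂ (mc v)) (≡.trans (indeg-split v) (≡.cong (indegM M′ v +_) (count-targets sc v)))))

-- Adding a simple cycle cs to a disjoint multicycle M increases the
-- number of cycles (numCycles of Defs, which counts the vertices that are
-- minimal on their cycle) by exactly one: off cs nothing changes, and on
-- cs exactly the least vertex of cs becomes a cycle minimum.
module CycleCount {c ℓ} (R : CommutativeRing c ℓ) (N : ℕ) (es : List (Edge N (CommutativeRing.Carrier R))) where

  open import Defs
  open import Data.Bool using (Bool; true; false; if_then_else_; _∧_)
  open import Data.Nat as ℕ using (zero; suc; _+_; _≤_; _<_; s≤s; z≤n)
  import Data.Nat.Properties as ℕP
  open import Data.Fin using (Fin; toℕ; fromℕ<)
  open import Data.Fin.Properties using (_≟_; toℕ-fromℕ<; toℕ-injective)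
  open import Data.List as L using (_∷_; _++_; map; foldr; length; allFin)
  import Data.List.Properties as LP
  open import Data.List.Membership.Propositional using (_∈_; _∉_)
  open import Data.List.Membership.Propositional.Properties using (∈-allFin; ∈-map⁺; ∈-++⁺ˡ; ∈-++⁺ʳ; ∈-++⁻; ∈-∃++)
  open import Data.List.Relation.Unary.Any using (here; there)
  import Data.List.Relation.Unary.All as All
  open import Data.List.Extrema ℕP.≤-totalOrder using (argmin; argmin-sel; f[argmin]≤f[xs])
  open import Data.Vec using (Vec; lookup)
  open import Data.Product using (_×_; _,_; proj₁; proj₂; ∃)
  open import Data.Sum using (inj₁; inj₂)
  open import Relation.Nullary using (yes; no)
  open import Relation.Nullary.Decidable using (⌊_⌋)
  open import Relation.Binary.PropositionalEquality as ≡ using (_≡_)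
  open BoolFacts
  open Masks
  open NatSums
  open IndexedEdges R N es
  open Walks R N es
  open MaskMulticycles R N es

  open Net R N using (iter; isCycleMin; numCycles)

  iter-suc : ∀ q (s : Fin N → Fin N) u → iter q s (s u) ≡ iter (suc q) s u
  iter-suc zero    s u = ≡.refl
  iter-suc (suc q) s u = ≡.cong s (iter-suc q s u)

  target-on-cycle : ∀ {c cs} → SimpleCycle c cs → ∀ k → k ∈ cs → tgtI k ∈ map srcI cs
  target-on-cycle {c} {cs} (loop , _) k k∈ with Loop⇒walk loop
  ... | walk , end with ∈-++⁻ (map srcI cs) (≡.subst (tgtI k ∈_) (sources-targets c cs walk) (there (∈-map⁺ tgtI k∈)))
  ... | inj₁ on-cycle  = on-cycle
  ... | inj₂ (here eq) = ≡.subst (_∈ map srcI cs) (≡.sym (≡.trans eq end)) (Loop-start loop)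

  private
    minimalOnOrbit : Vec Bool m → Fin N → Bool
    minimalOnOrbit X v = foldr _∧_ true (map (λ k → ⌊ toℕ v ℕ.≤? toℕ (iter (toℕ k) (succM X) v) ⌋) (allFin N))

    isCycleMin-mask : ∀ X v → isCycleMin (select es X) v ≡ (⌊ outdegM X v ℕ.≟ 1 ⌋ ∧ minimalOnOrbit X v)
    isCycleMin-mask X v = ≡.cong (λ d → ⌊ d ℕ.≟ 1 ⌋ ∧ minimalOnOrbit X v) (outdeg-select X v)

    ∧-congʳ-true : ∀ {a a′ b b′ : Bool} → a ≡ a′ → (a′ ≡ true → b ≡ b′) → (a ∧ b) ≡ (a′ ∧ b′)
    ∧-congʳ-true {a′ = true}  ≡.refl f = f ≡.refl
    ∧-congʳ-true {a′ = false} ≡.refl f = ≡.refl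

    ind : Bool → ℕ
    ind b = if b then 1 else 0

  module AddCycle (M : Vec Bool m) (c : Fin N) (cs : List (Fin m)) (mc : IsMulticycle M) (sc : SimpleCycle c cs)
                  (disj : DisjointFrom M cs) where

    M′ : Vec Bool m
    M′ = setBits cs M

    srcs : List (Fin N)
    srcs = map srcI cs

    private
      off = DisjointFrom⇒unselected M cs disj
      cs! = SimpleCycle-unique sc

    mc′ : IsMulticycle M′
    mc′ = IsMulticycle-setBits M c cs mc sc disj

    outdeg′ : ∀ v → outdegM M′ v ≡ outdegM M v + count v srcs
    outdeg′ = outdeg-setBits M cs cs! off

    succ-on-cycle : ∀ k → k ∈ cs → succM M′ (srcI k) ≡ tgtI k
    succ-on-cycle k k∈ = succM-edge M′ mc′ k (setBits-∈ M cs k k∈)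

    succ-off-cycle : ∀ u → 1 ≤ outdegM M u → succM M′ u ≡ succM M u
    succ-off-cycle u pos with leaving-edge M u pos
    ... | k , Mk , ≡.refl = ≡.trans (succM-edge M′ mc′ k (setBits-mono M cs k Mk)) (≡.sym (succM-edge M mc k Mk))

    orbit-on-cycle : ∀ q u → u ∈ srcs → iter q (succM M′) u ∈ srcs
    orbit-on-cycle zero    u u∈ = u∈
    orbit-on-cycle (suc q) u u∈ with edge-source _ cs (orbit-on-cycle q u u∈)
    ... | k , k∈ , eq rewrite ≡.sym eq | succ-on-cycle k k∈ = target-on-cycle sc k k∈

    rotation : ∀ u → u ∈ srcs → ∃ λ ds → IsWalk u ds × (∀ k → k ∈ ds → k ∈ cs) ×
                                         (∀ w → w ∈ srcs → w ∈ map srcI ds) × length ds ≡ length cs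
    rotation u u∈ with edge-source u cs u∈
    ... | k , k∈ , ≡.refl with ∈-∃++ k∈
    ... | ys , zs , ≡.refl with Loop⇒walk (proj₁ sc)
    ... | walk , end with IsWalk-++⁻ c ys (k ∷ zs) walk
    ... | walk-ys , (k↦ , walk-zs) =
      k ∷ zs ++ ys ,
      (≡.refl , IsWalk-++⁺ (tgtI k) zs ys walk-zs (≡.subst (λ w → IsWalk w ys) (≡.sym zs-end) walk-ys)) ,
      (λ k′ p → swap (k ∷ zs) ys p) ,
      (λ w p → ≡.subst (w ∈_) (≡.sym (LP.map-++ srcI (k ∷ zs) ys))
                 (swap (map srcI ys) (map srcI (k ∷ zs)) (≡.subst (w ∈_) (LP.map-++ srcI ys (k ∷ zs)) p))) ,
      LP.length-++-comm (k ∷ zs) ys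
      where
      swap : ∀ {a} {A : Set a} {x : A} xs ys → x ∈ xs ++ ys → x ∈ ys ++ xs
      swap xs ys p with ∈-++⁻ xs p
      ... | inj₁ q = ∈-++⁺ʳ ys q
      ... | inj₂ q = ∈-++⁺ˡ q
      zs-end : walkEnd (tgtI k) zs ≡ c
      zs-end = ≡.trans (≡.sym (≡.cong (λ w → walkEnd w (k ∷ zs)) k↦)) (≡.trans (≡.sym (walkEnd-++ c ys (k ∷ zs))) end)

    walk-visits : ∀ u ds → IsWalk u ds → (∀ k → k ∈ ds → k ∈ cs) → ∀ w → w ∈ map srcI ds →
                  ∃ λ q → q < length ds × iter q (succM M′) u ≡ w
    walk-visits u (k ∷ ds) (k↦u , _) _ w (here ≡.refl) = 0 , s≤s z≤n , ≡.sym k↦u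
    walk-visits u (k ∷ ds) (k↦u , walk) sub w (there p) with walk-visits (tgtI k) ds walk (λ k′ q → sub k′ (there q)) w p
    ... | q , q< , reach = suc q , s≤s q< ,
      ≡.trans (≡.sym (iter-suc q (succM M′) u))
              (≡.trans (≡.cong (iter q (succM M′)) (≡.trans (≡.cong (succM M′) (≡.sym k↦u)) (succ-on-cycle k (sub k (here ≡.refl))))) reach)

    visits : ∀ u w → u ∈ srcs → w ∈ srcs → ∃ λ q → q < N × iter q (succM M′) u ≡ w
    visits u w u∈ w∈ with rotation u u∈
    ... | ds , walk , sub , covers , len with walk-visits u ds walk sub w (covers w w∈)
    ... | q , q< , reach = q , ℕP.<-≤-trans q< (ℕP.≤-trans (ℕP.≤-reflexive len) cs-short) , reach
      where
      cs-short : length cs ≤ N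
      cs-short = ≡.subst (_≤ N) (LP.length-map srcI cs) (unique-length srcs (proj₂ sc))

    allBelow : Fin N → Bool
    allBelow v = foldr _∧_ true (map (λ w → ⌊ toℕ v ℕ.≤? toℕ w ⌋) srcs)

    leastOnCycle : Fin N → Bool
    leastOnCycle v = memB v srcs ∧ allBelow v

    on-cycle-M′ : ∀ v → v ∈ srcs → isCycleMin (select es M′) v ≡ leastOnCycle v
    on-cycle-M′ v v∈ with edge-source v cs v∈
    ... | k , k∈ , ≡.refl =
      ≡.trans (isCycleMin-mask M′ (srcI k)) (≡.trans (≡.cong (λ d → ⌊ d ℕ.≟ 1 ⌋ ∧ minimalOnOrbit M′ (srcI k)) deg1)
              (≡.trans (bool-ext orbit⇒cycle cycle⇒orbit) (≡.cong (_∧ allBelow (srcI k)) (≡.sym (memB-∈ v∈)))))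
      where
      deg1 : outdegM M′ (srcI k) ≡ 1
      deg1 = ≡.trans (outdeg′ (srcI k)) (≡.cong₂ _+_ (disj k k∈)
                      (ℕP.≤-antisym (count-unique (srcI k) _ (proj₂ sc)) (count-∈ (srcI k) _ (∈-map⁺ srcI k∈))))
      orbit⇒cycle : minimalOnOrbit M′ (srcI k) ≡ true → allBelow (srcI k) ≡ true
      orbit⇒cycle min = all-true⁺ _ srcs λ w w∈ → witness-true (toℕ (srcI k) ℕ.≤? toℕ w) (below w w∈)
        where
        below : ∀ w → w ∈ srcs → toℕ (srcI k) ≤ toℕ w
        below w w∈ with visits (srcI k) w v∈ w∈
        ... | q , q<N , reach =
          ≡.subst (λ z → toℕ (srcI k) ≤ toℕ z) reach
            (≡.subst (λ z → toℕ (srcI k) ≤ toℕ (iter z (succM M′) (srcI k))) (toℕ-fromℕ< q<N)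
              (true-witness (toℕ (srcI k) ℕ.≤? toℕ (iter (toℕ (fromℕ< q<N)) (succM M′) (srcI k)))
                (all-true⁻ _ (allFin N) min (fromℕ< q<N) (∈-allFin _))))
      cycle⇒orbit : allBelow (srcI k) ≡ true → minimalOnOrbit M′ (srcI k) ≡ true
      cycle⇒orbit min = all-true⁺ _ (allFin N) λ q _ →
        all-true⁻ _ srcs min (iter (toℕ q) (succM M′) (srcI k)) (orbit-on-cycle (toℕ q) (srcI k) v∈)

    on-cycle-M : ∀ v → v ∈ srcs → isCycleMin (select es M) v ≡ false
    on-cycle-M v v∈ with edge-source v cs v∈
    ... | k , k∈ , ≡.refl =
      ≡.trans (isCycleMin-mask M (srcI k)) (≡.cong (λ d → ⌊ d ℕ.≟ 1 ⌋ ∧ minimalOnOrbit M (srcI k)) (disj k k∈))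

    -- off cs, cycle minima of M and M′ agree: same degree and same orbit
    off-cycle : ∀ v → v ∉ srcs → isCycleMin (select es M′) v ≡ isCycleMin (select es M) v
    off-cycle v v∉ =
      ≡.trans (isCycleMin-mask M′ v)
        (≡.trans (∧-congʳ-true {b′ = minimalOnOrbit M v} (≡.cong (λ d → ⌊ d ℕ.≟ 1 ⌋) same-deg) same-orbit)
                 (≡.sym (isCycleMin-mask M v)))
      where
      same-deg : outdegM M′ v ≡ outdegM M v
      same-deg = ≡.trans (outdeg′ v) (≡.trans (≡.cong (outdegM M v +_) (count-∉ v srcs v∉)) (ℕP.+-identityʳ _))
      same-iter : 1 ≤ outdegM M v → ∀ q → iter q (succM M′) v ≡ iter q (succM M) v × 1 ≤ outdegM M (iter q (succM M) v)
      same-iter pos zero = ≡.refl , pos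
      same-iter pos (suc q) with same-iter pos q
      ... | eq , pos′ = ≡.trans (≡.cong (succM M′) eq) (succ-off-cycle _ pos′) , succM-closed M mc _ pos′
      same-orbit : ⌊ outdegM M v ℕ.≟ 1 ⌋ ≡ true → minimalOnOrbit M′ v ≡ minimalOnOrbit M v
      same-orbit deg1 = ≡.cong (foldr _∧_ true) (LP.map-cong (λ q → ≡.cong (λ z → ⌊ toℕ v ℕ.≤? toℕ z ⌋)
        (proj₁ (same-iter (ℕP.≤-reflexive (≡.sym (true-witness (outdegM M v ℕ.≟ 1) deg1))) (toℕ q)))) (allFin N))

    pointwise : ∀ v → ind (isCycleMin (select es M′) v) ≡ ind (isCycleMin (select es M) v) + ind (leastOnCycle v)
    pointwise v with DecMembership._∈?_ v srcs
    ... | yes v∈ rewrite on-cycle-M′ v v∈ | on-cycle-M v v∈ | memB-∈ {cs = srcs} v∈ = ≡.refl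
    ... | no  v∉ rewrite off-cycle v v∉ = ≡.sym (ℕP.+-identityʳ _)

    least : Fin N
    least = argmin toℕ c srcs

    least∈ : least ∈ srcs
    least∈ with argmin-sel toℕ c srcs
    ... | inj₁ eq = ≡.subst (_∈ srcs) (≡.sym eq) (Loop-start (proj₁ sc))
    ... | inj₂ p  = p

    least-below : ∀ w → w ∈ srcs → toℕ least ≤ toℕ w
    least-below w w∈ = All.lookup (f[argmin]≤f[xs] c srcs) w∈

    leastOnCycle≡ : ∀ v → leastOnCycle v ≡ ⌊ v ≟ least ⌋
    leastOnCycle≡ v = bool-ext is-least is-leastOnCycle
      where
      is-least : leastOnCycle v ≡ true → ⌊ v ≟ least ⌋ ≡ true
      is-least ok with ∧-true⁻ {memB v srcs} ok
      ... | v∈ , below = witness-true (v ≟ least) (toℕ-injective (ℕP.≤-antisym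
              (true-witness (toℕ v ℕ.≤? toℕ least) (all-true⁻ _ srcs below least least∈))
              (least-below v (memB-true v∈))))
      is-leastOnCycle : ⌊ v ≟ least ⌋ ≡ true → leastOnCycle v ≡ true
      is-leastOnCycle eq with true-witness (v ≟ least) eq
      ... | ≡.refl = ≡.cong₂ _∧_ (memB-∈ least∈) (all-true⁺ _ srcs λ w w∈ → witness-true (toℕ least ℕ.≤? toℕ w) (least-below w w∈))

    exactly-one-least : Sum (λ v → ind (leastOnCycle v)) (allFin N) ≡ 1
    exactly-one-least = ≡.trans (Sum-cong′ (allFin N) (λ v → ≡.cong ind (≡.trans (leastOnCycle≡ v) (isYes≗does (v ≟ least)))))
                                (Sum-delta (λ _ → 1) least)
      where open Relation.Nullary.Decidable using (isYes≗does)

    numCycles-setBits : numCycles (select es M′) ≡ suc (numCycles (select es M))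
    numCycles-setBits =
      ≡.trans (length-filterB≡Sum (isCycleMin (select es M′)) (allFin N))
      (≡.trans (Sum-cong′ (allFin N) pointwise)
      (≡.trans (Sum-∙ _ _ (allFin N))
      (≡.trans (≡.cong (_ +_) exactly-one-least)
      (≡.trans (ℕP.+-comm _ 1) (≡.cong suc (≡.sym (length-filterB≡Sum (isCycleMin (select es M)) (allFin N))))))))

-- The sign-reversing involution ι on pairs (M , ws) of an edge set M and
-- a walk ws from a.  Walk along ws and stop at the first vertex v that
-- either (1) was already visited, so that the walk just closed a simple
-- cycle — then move that cycle from the walk into M — or (2) lies on a
-- cycle of M — then move that cycle from M into the walk.  A walk without
-- such a vertex is simple and left alone.  Each move changes M by one
-- cycle and keeps the end point, the total shift and the total weight.
module CycleSwap {c ℓ} (R : CommutativeRing c ℓ) (N : ℕ) (es : List (Edge N (CommutativeRing.Carrier R)))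
  (a : Fin N) where

  open import Defs
  open import Data.Bool using (Bool; true; false; if_then_else_)
  open import Data.Nat as ℕ using (suc; _+_; _≤_)
  open import Data.Integer.Tactic.RingSolver using (solve-∀)
  import Data.Nat.Properties as ℕP
  open import Data.Integer as ℤ using (ℤ)
  open import Data.Fin.Properties using (_≟_)
  open import Data.Maybe as Maybe using (Maybe; just; nothing)
  open import Data.List as L using ([]; _∷_; [_]; _++_; map; length; take; drop)
  import Data.List.Properties as LP
  open import Data.List.Membership.Propositional using (_∈_; _∉_)
  open import Data.List.Membership.Propositional.Properties using (∈-map⁺; ∈-++⁺ˡ; ∈-++⁺ʳ; ∈-++⁻)
  open import Data.List.Relation.Unary.Any using (here; there)
  open import Data.List.Relation.Unary.All using () renaming (lookup to All-lookup)
  open import Data.List.Relation.Unary.AllPairs using ([]; _∷_)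
  import Data.List.Relation.Unary.All as All
  open import Data.List.Relation.Unary.Unique.Propositional using (Unique)
  import Data.List.Relation.Unary.Unique.Propositional.Properties as UniqueP
  open import Data.Vec using (Vec; lookup)
  open import Data.Product using (_×_; _,_; proj₁; proj₂; ∃₂)
  open import Data.Sum using (_⊎_; inj₁; inj₂)
  open import Data.Unit using (tt)
  open import Relation.Nullary using (¬_; Dec; yes; no)
  open import Relation.Nullary.Decidable using (⌊_⌋)
  open import Relation.Binary.PropositionalEquality as ≡ using (_≡_; _≢_)
  open import Data.Empty using (⊥-elim)
  open Masks
  open ListFacts
  open NatSums using (count-∉)
  open IndexedEdges R N es
  open Walks R N es
  open MaskMulticycles R N es
  open CycleExtraction R N es using (cycleThrough; cycleThrough-unique; cycleThrough-spec)
  open RemoveCycle R N es using (module Removal)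
  open CycleCount R N es using (module AddCycle)

  State : Set
  State = Vec Bool m × List (Fin m)

  firstIndexOf : Fin N → List (Fin N) → Maybe ℕ
  firstIndexOf v []       = nothing
  firstIndexOf v (w ∷ ws) = if ⌊ w ≟ v ⌋ then just 0 else Maybe.map suc (firstIndexOf v ws)

  -- scan M acc v ws: the walk acc has been followed up to the vertex v and
  -- ws remains to be followed
  mutual
    scan : Vec Bool m → List (Fin m) → Fin N → List (Fin m) → State
    scan M acc v ws = scan-repeat M acc v ws (firstIndexOf v (map srcI acc))

    scan-repeat : Vec Bool m → List (Fin m) → Fin N → List (Fin m) → Maybe ℕ → State
    scan-repeat M acc v ws (just p) = setBits (drop p acc) M , take p acc ++ ws
    scan-repeat M acc v ws nothing  = scan-covered M acc v ws (outdegM M v ℕ.≟ 0)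

    scan-covered : (M : Vec Bool m) → List (Fin m) → (v : Fin N) → List (Fin m) → Dec (outdegM M v ≡ 0) → State
    scan-covered M acc v ws       (no _)  = clearBits (cycleThrough M v) M , acc ++ cycleThrough M v ++ ws
    scan-covered M acc v []       (yes _) = M , acc
    scan-covered M acc v (k ∷ ws) (yes _) = scan M (acc ++ [ k ]) (tgtI k) ws

  ι : State → State
  ι (M , ws) = scan M [] a ws

  firstIndexOf-∉ : ∀ v vs → v ∉ vs → firstIndexOf v vs ≡ nothing
  firstIndexOf-∉ v []       _  = ≡.refl
  firstIndexOf-∉ v (w ∷ vs) v∉ with w ≟ v
  ... | yes ≡.refl = ⊥-elim (v∉ (here ≡.refl))
  ... | no  _      = ≡.cong (Maybe.map suc) (firstIndexOf-∉ v vs (λ p → v∉ (there p)))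

  firstIndexOf-nothing : ∀ v vs → firstIndexOf v vs ≡ nothing → v ∉ vs
  firstIndexOf-nothing v (w ∷ vs) eq v∈ with w ≟ v | v∈
  ... | yes _ | _ with eq
  ...   | ()
  firstIndexOf-nothing v (w ∷ vs) eq v∈ | no w≢v | here v≡w = w≢v (≡.sym v≡w)
  firstIndexOf-nothing v (w ∷ vs) eq v∈ | no _   | there v∈vs with firstIndexOf v vs in rest
  ... | nothing = firstIndexOf-nothing v vs rest v∈vs

  firstIndexOf-first : ∀ v xs ys → v ∉ xs → firstIndexOf v (xs ++ v ∷ ys) ≡ just (length xs)
  firstIndexOf-first v []       ys _ with v ≟ v
  ... | yes _   = ≡.refl
  ... | no  v≢v = ⊥-elim (v≢v ≡.refl)
  firstIndexOf-first v (w ∷ xs) ys v∉ with w ≟ v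
  ... | yes ≡.refl = ⊥-elim (v∉ (here ≡.refl))
  ... | no  _      = ≡.cong (Maybe.map suc) (firstIndexOf-first v xs ys (λ p → v∉ (there p)))

  firstIndexOf-just : ∀ v (acc : List (Fin m)) p → firstIndexOf v (map srcI acc) ≡ just p →
                      ∃₂ λ k rest → drop p acc ≡ k ∷ rest × srcI k ≡ v
  firstIndexOf-just v (k ∷ acc) p eq with srcI k ≟ v
  firstIndexOf-just v (k ∷ acc) .0 ≡.refl | yes k↦v = k , acc , ≡.refl , k↦v
  ... | no _ with firstIndexOf v (map srcI acc) in found
  firstIndexOf-just v (k ∷ acc) .(suc p′) ≡.refl | no _ | just p′ = firstIndexOf-just v acc p′ found

  scan-repeat-cong : ∀ M acc v ws {x y} → x ≡ y → scan-repeat M acc v ws x ≡ scan-repeat M acc v ws y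
  scan-repeat-cong M acc v ws ≡.refl = ≡.refl

  scan-free : ∀ M acc v k ws → outdegM M v ≡ 0 → scan-covered M acc v (k ∷ ws) (outdegM M v ℕ.≟ 0) ≡ scan M (acc ++ [ k ]) (tgtI k) ws
  scan-free M acc v k ws free with outdegM M v ℕ.≟ 0
  ... | yes _ = ≡.refl
  ... | no  ¬free = ⊥-elim (¬free free)

  scan-enter : ∀ M acc v ws → 1 ≤ outdegM M v →
               scan-covered M acc v ws (outdegM M v ℕ.≟ 0) ≡ (clearBits (cycleThrough M v) M , acc ++ cycleThrough M v ++ ws)
  scan-enter M acc v ws covered with outdegM M v ℕ.≟ 0
  ... | no _ = ≡.refl
  ... | yes free with ≡.subst (1 ≤_) free covered
  ...   | ()

  Avoids : Vec Bool m → List (Fin m) → Set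
  Avoids M pre = ∀ k → k ∈ pre → outdegM M (srcI k) ≡ 0

  scan-through : ∀ M acc v pre post → IsWalk v pre → Unique (map srcI pre) → (∀ k → k ∈ pre → srcI k ∉ map srcI acc) →
                 Avoids M pre → scan M acc v (pre ++ post) ≡ scan M (acc ++ pre) (walkEnd v pre) post
  scan-through M acc v [] post _ _ _ _ rewrite LP.++-identityʳ acc = ≡.refl
  scan-through M acc v (k ∷ pre) post (≡.refl , walk) (k∉ ∷ pre!) fresh avoids =
    ≡.trans (scan-repeat-cong M acc (srcI k) (k ∷ pre ++ post) (firstIndexOf-∉ (srcI k) (map srcI acc) (fresh k (here ≡.refl))))
    (≡.trans (scan-free M acc (srcI k) k (pre ++ post) (avoids k (here ≡.refl)))
    (≡.trans (scan-through M (acc ++ [ k ]) (tgtI k) pre post walk pre! fresh′ (λ k′ p → avoids k′ (there p)))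
             (≡.cong (λ z → scan M z (walkEnd (tgtI k) pre) post) (LP.++-assoc acc [ k ] pre))))
    where
    fresh′ : ∀ k′ → k′ ∈ pre → srcI k′ ∉ map srcI (acc ++ [ k ])
    fresh′ k′ p q with ∈-++⁻ (map srcI acc) (≡.subst (srcI k′ ∈_) (LP.map-++ srcI acc [ k ]) q)
    ... | inj₁ r         = fresh k′ (there p) r
    ... | inj₂ (here eq) = All-lookup k∉ (∈-map⁺ srcI p) (≡.sym eq)

  walk⇒Loop : ∀ c u ds → IsWalk u ds → walkEnd u ds ≡ c → (∀ k → k ∈ drop 1 ds → srcI k ≢ c) → ds ≢ [] → Loop c u ds
  walk⇒Loop c u []            _              _   _     nonempty = ⊥-elim (nonempty ≡.refl)
  walk⇒Loop c u (k ∷ [])      (k↦u , _)     end _     _        = last k↦u end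
  walk⇒Loop c u (k ∷ k′ ∷ ds) (k↦u , walk) end later _        =
    more k↦u (λ k↣c → later k′ (here ≡.refl) (≡.trans (proj₁ walk) k↣c))
         (walk⇒Loop c (tgtI k) (k′ ∷ ds) walk end (λ k″ p → later k″ (there p)) (λ ()))

  first-edge-source : ∀ {u ds k rest} → ds ≡ k ∷ rest → IsWalk u ds → srcI k ≡ u
  first-edge-source ≡.refl (k↦u , _) = k↦u

  later-sources : ∀ {ds k rest} → ds ≡ k ∷ rest → Unique (map srcI ds) → ∀ k′ → k′ ∈ drop 1 ds → srcI k′ ≢ srcI k
  later-sources ≡.refl (k∉ ∷ _) k′ q eq = All-lookup k∉ (∈-map⁺ srcI q) (≡.sym eq)

  SimplePrefix : Vec Bool m → List (Fin m) → Set
  SimplePrefix M pre = IsWalk a pre × Unique (map srcI pre) × Avoids M pre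

  data ScanOutcome (M : Vec Bool m) (ws : List (Fin m)) (res : State) : Set where
    closes : ∀ pre cyc post → ws ≡ pre ++ cyc ++ post → SimplePrefix M pre →
             SimpleCycle (walkEnd a pre) cyc → DisjointFrom M cyc → (∀ k → k ∈ cyc → srcI k ∉ map srcI pre) →
             IsWalk (walkEnd a pre) post → res ≡ (setBits cyc M , pre ++ post) → ScanOutcome M ws res
    enters : ∀ pre post → ws ≡ pre ++ post → SimplePrefix M pre →
             1 ≤ outdegM M (walkEnd a pre) → walkEnd a pre ∉ map srcI pre → IsWalk (walkEnd a pre) post →
             res ≡ (clearBits (cycleThrough M (walkEnd a pre)) M , pre ++ cycleThrough M (walkEnd a pre) ++ post) →
             ScanOutcome M ws res
    simple : Unique (map srcI ws) → ScanOutcome M ws res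

  repeat-outcome : ∀ M acc ws p → SimplePrefix M acc → IsWalk (walkEnd a acc) ws →
                   firstIndexOf (walkEnd a acc) (map srcI acc) ≡ just p →
                   ScanOutcome M (acc ++ ws) (setBits (drop p acc) M , take p acc ++ ws)
  repeat-outcome M acc ws p (walk , acc! , avoids) walk-ws found with firstIndexOf-just (walkEnd a acc) acc p found
  ... | k , rest , cyc≡ , k↦ =
    closes pre cyc ws split (walk-pre , pre! , λ k′ q → avoids k′ (in-acc (∈-++⁺ˡ q))) simple-cycle
           (λ k′ q → avoids k′ (in-acc (∈-++⁺ʳ pre q))) (λ k′ q r → pre#cyc (∈-map⁺ srcI q) r)
           (≡.subst (λ w → IsWalk w ws) (≡.sym start≡) walk-ws) ≡.refl
    where
    pre = take p acc
    cyc = drop p acc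
    acc≡ : acc ≡ pre ++ cyc
    acc≡ = ≡.sym (LP.take++drop≡id p acc)
    split : acc ++ ws ≡ pre ++ cyc ++ ws
    split = ≡.trans (≡.cong (_++ ws) acc≡) (LP.++-assoc pre cyc ws)
    in-acc : ∀ {k′} → k′ ∈ pre ++ cyc → k′ ∈ acc
    in-acc q = ≡.subst (_ ∈_) (≡.sym acc≡) q
    walks = IsWalk-++⁻ a pre cyc (≡.subst (IsWalk a) acc≡ walk)
    walk-pre = proj₁ walks
    walk-cyc = proj₂ walks
    parts = Unique-++⁻ (map srcI pre) (map srcI cyc)
              (≡.subst Unique (LP.map-++ srcI pre cyc) (≡.subst (λ z → Unique (map srcI z)) acc≡ acc!))
    pre! = proj₁ parts
    cyc! = proj₁ (proj₂ parts)
    pre#cyc = proj₂ (proj₂ parts)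
    start≡ : walkEnd a pre ≡ walkEnd a acc
    start≡ = ≡.trans (≡.sym (first-edge-source cyc≡ walk-cyc)) k↦
    simple-cycle : SimpleCycle (walkEnd a pre) cyc
    simple-cycle = walk⇒Loop _ _ cyc walk-cyc closed later nonempty , cyc!
      where
      closed : walkEnd (walkEnd a pre) cyc ≡ walkEnd a pre
      closed = ≡.trans (≡.sym (walkEnd-++ a pre cyc)) (≡.trans (≡.cong (walkEnd a) (≡.sym acc≡)) (≡.sym start≡))
      nonempty : cyc ≢ []
      nonempty eq with ≡.trans (≡.sym eq) cyc≡
      ... | ()
      later : ∀ k′ → k′ ∈ drop 1 cyc → srcI k′ ≢ walkEnd a pre
      later k′ q eq = later-sources cyc≡ cyc! k′ q (≡.trans eq (≡.trans start≡ (≡.sym k↦)))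

  scan-outcome : ∀ M acc ws → SimplePrefix M acc → IsWalk (walkEnd a acc) ws →
                 ScanOutcome M (acc ++ ws) (scan M acc (walkEnd a acc) ws)
  scan-outcome M acc ws prefix walk-ws with firstIndexOf (walkEnd a acc) (map srcI acc) in found
  ... | just p = repeat-outcome M acc ws p prefix walk-ws found
  ... | nothing with outdegM M (walkEnd a acc) ℕ.≟ 0
  ...   | no covered = enters acc ws ≡.refl prefix (ℕP.n≢0⇒n>0 covered) (firstIndexOf-nothing _ _ found) walk-ws ≡.refl
  scan-outcome M acc [] (_ , acc! , _) _ | nothing | yes _ =
    simple (≡.subst (λ w → Unique (map srcI w)) (≡.sym (LP.++-identityʳ acc)) acc!)
  scan-outcome M acc (k ∷ ws) (walk , acc! , avoids) (k↦ , walk-ws) | nothing | yes free =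
    ≡.subst (λ W → ScanOutcome M W (scan M (acc ++ [ k ]) (tgtI k) ws)) (LP.++-assoc acc [ k ] ws)
      (≡.subst (λ w → ScanOutcome M ((acc ++ [ k ]) ++ ws) (scan M (acc ++ [ k ]) w ws)) end′
        (scan-outcome M (acc ++ [ k ]) ws (walk′ , acc!′ , avoids′) (≡.subst (λ w → IsWalk w ws) (≡.sym end′) walk-ws)))
    where
    end′ : walkEnd a (acc ++ [ k ]) ≡ tgtI k
    end′ = walkEnd-++ a acc [ k ]
    walk′ : IsWalk a (acc ++ [ k ])
    walk′ = IsWalk-++⁺ a acc [ k ] walk (k↦ , tt)
    acc!′ : Unique (map srcI (acc ++ [ k ]))
    acc!′ = ≡.subst Unique (≡.sym (LP.map-++ srcI acc [ k ]))
              (UniqueP.++⁺ acc! (All.[] ∷ [])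
                λ { (q , here ≡.refl) → firstIndexOf-nothing _ _ found (≡.subst (_∈ map srcI acc) k↦ q) })
    avoids′ : Avoids M (acc ++ [ k ])
    avoids′ k′ q with ∈-++⁻ acc q
    ... | inj₁ r             = avoids k′ r
    ... | inj₂ (here ≡.refl) = ≡.trans (≡.cong (outdegM M) k↦) free

  open CommutativeRing R using (Carrier; _≈_; _*_; trans; sym; *-congˡ; *-congʳ; *-comm; *-assoc)
  open Net R N using (numCycles)

  record CycleMove (x y : State) : Set ℓ where
    field
      cycle        : List (Fin m)
      windM≡       : windM (proj₁ y) ≡ windM (proj₁ x) ℤ.+ walkShift cycle
      walkShift≡   : walkShift (proj₂ x) ≡ walkShift (proj₂ y) ℤ.+ walkShift cycle
      wtM≈         : wtM (proj₁ y) ≈ wtM (proj₁ x) * walkWeight cycle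
      walkWeight≈  : walkWeight (proj₂ x) ≈ walkWeight (proj₂ y) * walkWeight cycle
      numCycles≡   : numCycles (select es (proj₁ y)) ≡ suc (numCycles (select es (proj₁ x)))

  move-cycle : ∀ M v cyc pre post → IsMulticycle M → SimpleCycle v cyc → DisjointFrom M cyc →
               CycleMove (M , pre ++ cyc ++ post) (setBits cyc M , pre ++ post)
  move-cycle M v cyc pre post mc sc disj = record
    { cycle       = cyc
    ; windM≡      = windM-setBits M cyc cyc! off
    ; walkShift≡  = ≡.trans (walkShift-++ pre (cyc ++ post))
                      (≡.trans (≡.cong (λ w → walkShift pre ℤ.+ w) (walkShift-++ cyc post))
                      (≡.trans (rotate (walkShift pre) (walkShift cyc) (walkShift post))
                               (≡.cong (λ w → w ℤ.+ walkShift cyc) (≡.sym (walkShift-++ pre post)))))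
    ; wtM≈        = wtM-setBits M cyc cyc! off
    ; walkWeight≈ = trans (walkWeight-++ pre (cyc ++ post))
                      (trans (*-congˡ (walkWeight-++ cyc post))
                      (trans (trans (*-congˡ (*-comm _ _)) (sym (*-assoc _ _ _)))
                             (*-congʳ (sym (walkWeight-++ pre post)))))
    ; numCycles≡  = AddCycle.numCycles-setBits M v cyc mc sc disj
    }
    where
    cyc! = SimpleCycle-unique sc
    off  = DisjointFrom⇒unselected M cyc disj
    rotate : ∀ (x y z : ℤ) → x ℤ.+ (y ℤ.+ z) ≡ (x ℤ.+ z) ℤ.+ y
    rotate = solve-∀

  record Swapped (x y : State) : Set ℓ where
    field
      multicycle : IsMulticycle (proj₁ y)
      walk       : IsWalk a (proj₂ y)
      same-end   : walkEnd a (proj₂ y) ≡ walkEnd a (proj₂ x)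
      move       : CycleMove x y ⊎ CycleMove y x
      ι-back     : ι y ≡ x
      moved      : y ≢ x

  private
    true≢false : true ≢ false
    true≢false ()

  module CloseCycle (M : Vec Bool m) (pre cyc post : List (Fin m)) (mc : IsMulticycle M) (prefix : SimplePrefix M pre)
                    (sc : SimpleCycle (walkEnd a pre) cyc) (disj : DisjointFrom M cyc)
                    (cyc#pre : ∀ k → k ∈ cyc → srcI k ∉ map srcI pre) (walk-post : IsWalk (walkEnd a pre) post) where

    v : Fin N
    v = walkEnd a pre

    M′ : Vec Bool m
    M′ = setBits cyc M

    private
      walk-pre = proj₁ prefix
      pre!     = proj₁ (proj₂ prefix)
      avoids   = proj₂ (proj₂ prefix)
      cyc! = SimpleCycle-unique sc
      off  = DisjointFrom⇒unselected M cyc disj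
      first = edge-source v cyc (Loop-start (proj₁ sc))
      k₀  = proj₁ first
      k₀∈ = proj₁ (proj₂ first)
      k₀↦ = proj₂ (proj₂ first)

    closed : walkEnd v cyc ≡ v
    closed = proj₂ (Loop⇒walk (proj₁ sc))

    mc′ : IsMulticycle M′
    mc′ = IsMulticycle-setBits M v cyc mc sc disj

    avoids′ : Avoids M′ pre
    avoids′ k k∈ = ≡.trans (outdeg-setBits M cyc cyc! off (srcI k)) (≡.cong₂ _+_ (avoids k k∈) (count-∉ (srcI k) (map srcI cyc) not-on-cycle))
      where
      not-on-cycle : srcI k ∉ map srcI cyc
      not-on-cycle p with edge-source (srcI k) cyc p
      ... | k′ , k′∈ , eq = cyc#pre k′ k′∈ (≡.subst (_∈ map srcI pre) (≡.sym eq) (∈-map⁺ srcI k∈))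

    v∉pre : v ∉ map srcI pre
    v∉pre = ≡.subst (_∉ map srcI pre) k₀↦ (cyc#pre k₀ k₀∈)

    covered : 1 ≤ outdegM M′ v
    covered = ≡.subst (λ w → 1 ≤ outdegM M′ w) k₀↦ (selected-out M′ k₀ (setBits-∈ M cyc k₀ k₀∈))

    -- ι undoes the move: the scan of the new state stops at v and reinserts cyc
    ι-back : scan M′ [] a (pre ++ post) ≡ (M , pre ++ cyc ++ post)
    ι-back = begin
      scan M′ [] a (pre ++ post)                       ≡⟨ scan-through M′ [] a pre post walk-pre pre! (λ _ _ ()) avoids′ ⟩
      scan M′ pre v post                               ≡⟨ scan-repeat-cong M′ pre v post (firstIndexOf-∉ v (map srcI pre) v∉pre) ⟩
      scan-covered M′ pre v post (outdegM M′ v ℕ.≟ 0) ≡⟨ scan-enter M′ pre v post covered ⟩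
      (clearBits (cycleThrough M′ v) M′ , pre ++ cycleThrough M′ v ++ post)
        ≡⟨ ≡.cong (λ z → clearBits z M′ , pre ++ z ++ post) (cycleThrough-unique M′ mc′ v cyc sc (setBits-∈ M cyc)) ⟩
      (clearBits cyc M′ , pre ++ cyc ++ post)          ≡⟨ ≡.cong (_, pre ++ cyc ++ post) (clearBits-setBits cyc M off) ⟩
      (M , pre ++ cyc ++ post)                         ∎
      where open ≡.≡-Reasoning

    swapped : Swapped (M , pre ++ cyc ++ post) (M′ , pre ++ post)
    swapped = record
      { multicycle = mc′
      ; walk       = IsWalk-++⁺ a pre post walk-pre walk-post
      ; same-end   = ≡.trans (walkEnd-++ a pre post)
                       (≡.sym (≡.trans (walkEnd-++ a pre (cyc ++ post)) (≡.trans (walkEnd-++ v cyc post) (≡.cong (λ w → walkEnd w post) closed))))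
      ; move       = inj₁ (move-cycle M v cyc pre post mc sc disj)
      ; ι-back     = ι-back
      ; moved      = λ eq → true≢false (≡.trans (≡.sym (setBits-∈ M cyc k₀ k₀∈)) (≡.trans (≡.cong (λ z → lookup (proj₁ z) k₀) eq) (off k₀ k₀∈)))
      }

  module OpenCycle (M : Vec Bool m) (pre post : List (Fin m)) (mc : IsMulticycle M) (prefix : SimplePrefix M pre)
                   (covered : 1 ≤ outdegM M (walkEnd a pre)) (v∉pre : walkEnd a pre ∉ map srcI pre)
                   (walk-post : IsWalk (walkEnd a pre) post) where

    v : Fin N
    v = walkEnd a pre

    cyc : List (Fin m)
    cyc = cycleThrough M v

    private
      walk-pre = proj₁ prefix
      pre!     = proj₁ (proj₂ prefix)
      avoids   = proj₂ (proj₂ prefix)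
      spec = cycleThrough-spec M mc v covered
      sc   = proj₁ spec
      inM  = proj₂ spec

    open Removal M v cyc mc sc inM public

    walk-cyc : IsWalk v cyc
    walk-cyc = proj₁ (Loop⇒walk (proj₁ sc))

    closed : walkEnd v cyc ≡ v
    closed = proj₂ (Loop⇒walk (proj₁ sc))

    first : ∃₂ λ k rest → cyc ≡ k ∷ rest × srcI k ≡ v
    first with cyc | proj₁ sc
    ... | _ | last k↦ _   = _ , _ , ≡.refl , k↦
    ... | _ | more k↦ _ _ = _ , _ , ≡.refl , k↦

    private
      k₀   = proj₁ first
      rest = proj₁ (proj₂ first)
      cyc≡ = proj₁ (proj₂ (proj₂ first))
      k₀↦  = proj₂ (proj₂ (proj₂ first))
      k₀∈ : k₀ ∈ cyc
      k₀∈ = ≡.subst (k₀ ∈_) (≡.sym cyc≡) (here ≡.refl)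

    avoids′ : Avoids M′ pre
    avoids′ k k∈ = ℕP.m+n≡0⇒m≡0 _ (≡.trans (≡.sym (outdeg-split (srcI k))) (avoids k k∈))

    -- the prefix avoids M, so it avoids the cycle of M
    cyc#pre : ∀ k → k ∈ cyc → srcI k ∉ map srcI pre
    cyc#pre k k∈ p with edge-source (srcI k) pre p
    ... | k′ , k′∈ , k′↦ with ≡.subst (1 ≤_) (≡.trans (≡.cong (outdegM M) (≡.sym k′↦)) (avoids k′ k′∈)) (selected-out M k (inM k k∈))
    ... | ()

    position : firstIndexOf v (map srcI (pre ++ cyc)) ≡ just (length pre)
    position = ≡.trans (≡.cong (firstIndexOf v) (≡.trans (LP.map-++ srcI pre cyc) (≡.cong (λ z → map srcI pre ++ map srcI z) cyc≡)))
               (≡.trans (≡.cong (λ z → firstIndexOf v (map srcI pre ++ z ∷ map srcI rest)) k₀↦)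
               (≡.trans (firstIndexOf-first v (map srcI pre) (map srcI rest) v∉pre) (≡.cong just (LP.length-map srcI pre))))

    ι-back : scan M′ [] a (pre ++ cyc ++ post) ≡ (M , pre ++ post)
    ι-back = begin
      scan M′ [] a (pre ++ cyc ++ post)         ≡⟨ scan-through M′ [] a pre (cyc ++ post) walk-pre pre! (λ _ _ ()) avoids′ ⟩
      scan M′ pre v (cyc ++ post)               ≡⟨ scan-through M′ pre v cyc post walk-cyc (proj₂ sc) cyc#pre M′-disjoint ⟩
      scan M′ (pre ++ cyc) (walkEnd v cyc) post ≡⟨ ≡.cong (λ w → scan M′ (pre ++ cyc) w post) closed ⟩
      scan M′ (pre ++ cyc) v post               ≡⟨ scan-repeat-cong M′ (pre ++ cyc) v post position ⟩
      (setBits (drop (length pre) (pre ++ cyc)) M′ , take (length pre) (pre ++ cyc) ++ post)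
        ≡⟨ ≡.cong₂ (λ z w → setBits z M′ , w ++ post) (drop-length-++ pre cyc) (take-length-++ pre cyc) ⟩
      (setBits cyc M′ , pre ++ post)            ≡⟨ ≡.cong (_, pre ++ post) M′+cs≡M ⟩
      (M , pre ++ post)                         ∎
      where open ≡.≡-Reasoning

    swapped : Swapped (M , pre ++ post) (M′ , pre ++ cyc ++ post)
    swapped = record
      { multicycle = M′-multicycle
      ; walk       = IsWalk-++⁺ a pre (cyc ++ post) walk-pre
                       (IsWalk-++⁺ v cyc post walk-cyc (≡.subst (λ w → IsWalk w post) (≡.sym closed) walk-post))
      ; same-end   = ≡.trans (walkEnd-++ a pre (cyc ++ post))
                       (≡.trans (walkEnd-++ v cyc post) (≡.trans (≡.cong (λ w → walkEnd w post) closed) (≡.sym (walkEnd-++ a pre post))))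
      ; move       = inj₂ (≡.subst (λ z → CycleMove (M′ , pre ++ cyc ++ post) (z , pre ++ post)) M′+cs≡M
                             (move-cycle M′ v cyc pre post M′-multicycle sc M′-disjoint))
      ; ι-back     = ι-back
      ; moved      = λ eq → true≢false (≡.sym (≡.trans (≡.sym (M′-off k₀ k₀∈)) (≡.trans (≡.cong (λ z → lookup (proj₁ z) k₀) eq) (inM k₀ k₀∈))))
      }

  ι-swaps : ∀ M ws → IsMulticycle M → IsWalk a ws → ¬ Unique (map srcI ws) → Swapped (M , ws) (ι (M , ws))
  ι-swaps M ws mc walk not-simple with scan-outcome M [] ws (tt , [] , λ _ ()) walk
  ... | simple ws! = ⊥-elim (not-simple ws!)
  ... | closes pre cyc post ≡.refl prefix sc disj cyc#pre walk-post res =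
    ≡.subst (Swapped (M , pre ++ cyc ++ post)) (≡.sym res) (CloseCycle.swapped M pre cyc post mc prefix sc disj cyc#pre walk-post)
  ... | enters pre post ≡.refl prefix covered v∉pre walk-post res =
    ≡.subst (Swapped (M , pre ++ post)) (≡.sym res) (OpenCycle.swapped M pre post mc prefix covered v∉pre walk-post)

module WindingBounds {c ℓ} (R : CommutativeRing c ℓ) (N : ℕ) (es : List (Edge N (CommutativeRing.Carrier R))) where

  open import Defs
  open import Data.Bool using (true; false; if_then_else_; T)
  import Data.Bool as Bool
  open import Data.Nat as ℕ using (zero; suc; _+_; _*_; _≤_)
  import Data.Nat.Properties as ℕP
  open import Data.Integer as ℤ using (ℤ)
  import Data.Integer.Properties as ℤP
  open import Data.Fin using (Fin)
  open import Data.Fin.Properties using (any?)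
  open import Data.List as L using ([]; _∷_; map; foldr; length; allFin)
  open import Data.List.Membership.Propositional using (_∈_)
  open import Data.List.Membership.Propositional.Properties using (∈-map⁺; ∈-filter⁺)
  open import Data.List.Relation.Unary.Any using (here; there)
  open import Data.Vec using (lookup)
  open import Data.Product using (_,_; proj₁; proj₂)
  open import Data.Unit using (tt)
  open import Relation.Nullary using (yes; no)
  open import Relation.Binary.PropositionalEquality as ≡ using (_≡_)
  open import Data.Empty using (⊥-elim)
  open import Function using (_∘_)
  open Masks
  open NatSums using (term≤Sum)
  open IndexedEdges R N es
  open Walks R N es
  open MaskMulticycles R N es
  open CycleExtraction R N es using (cycleThrough; cycleThrough-spec)
  open RemoveCycle R N es using (module Removal)

  open CommutativeRing R using (Carrier; _≈_; 0#; trans)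
  open Net R N
  open RingSums R using (Sum; Sum-filter; Sum-map)

  select-multicycle : ∀ M → IsMulticycle M → select es M ∈ multicycles es
  select-multicycle M mc =
    ∈-filter⁺ _ (≡.subst (select es M ∈_) (≡.sym (subsets-select es)) (∈-map⁺ (select es) (masks-complete m M)))
                (≡.subst T (≡.sym (isMulticycleM⁺ M mc)) tt)

  Sum-multicycles : ∀ (h : List E → Carrier) →
                    Sum h (multicycles es) ≈ Sum (λ M → if isMulticycleM M then h (select es M) else 0#) (masks m)
  Sum-multicycles h = trans (Sum-filter isMulticycle _ h (subsets es))
    (CommutativeRing.reflexive R (≡.trans (≡.cong (Sum (λ S → if isMulticycle S then h S else 0#)) (subsets-select es))
                                          (Sum-map (λ S → if isMulticycle S then h S else 0#) (select es) (masks m))))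

  ⊔-member : ∀ (z x : ℤ) xs → x ∈ xs → x ℤ.≤ foldr ℤ._⊔_ z xs
  ⊔-member z x (y ∷ xs) (here ≡.refl) = ℤP.i≤i⊔j x _
  ⊔-member z x (y ∷ xs) (there x∈)    = ℤP.≤-trans (⊔-member z x xs x∈) (ℤP.i≤j⊔i y _)

  ⊔-base : ∀ (z : ℤ) xs → z ℤ.≤ foldr ℤ._⊔_ z xs
  ⊔-base z []       = ℤP.≤-refl
  ⊔-base z (y ∷ xs) = ℤP.≤-trans (⊔-base z xs) (ℤP.i≤j⊔i y _)

  windM≤maxWind : ∀ M → IsMulticycle M → windM M ℤ.≤ maxWind es
  windM≤maxWind M mc = ≡.subst (ℤ._≤ maxWind es) (wind-select M)
    (⊔-member (ℤ.+ 0) (wind (select es M)) (map wind (multicycles es)) (∈-map⁺ wind (select-multicycle M mc)))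

  0≤maxWind : ℤ.+ 0 ℤ.≤ maxWind es
  0≤maxWind = ⊔-base (ℤ.+ 0) (map wind (multicycles es))

  module _ (acyclic : Acyclic es) where

    cycle-shift-positive : ∀ v cs → SimpleCycle v cs → ℤ.+ 0 ℤ.< walkShift cs
    cycle-shift-positive v cs (loop , _) with Loop⇒walk loop
    ... | walk , end with walk⇒path v (ℤ.+ 0) cs walk
    ... | p , len = acyclic v (ℤ.+ 0) (walkShift cs) (≡.subst (Path es _ ∘ at) end p)
                      (≡.subst (1 ≤_) (≡.sym (≡.trans (pathLength-subst at end p) len)) (Loop-nonempty loop))
      where
      at : Fin N → LVertex N
      at w = w , ℤ.+ 0 ℤ.+ walkShift cs

    -- a multicycle is a disjoint union of simple cycles, each winding
    -- positively; induction on the number of edges, removing one cycle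
    windM≥0′ : ∀ fuel M → size M ≤ fuel → IsMulticycle M → ℤ.+ 0 ℤ.≤ windM M
    windM≥0′ fuel M small mc with any? (λ k → lookup M k Bool.≟ true)
    ... | no empty = ℤP.≤-reflexive (≡.sym (ℤΣ.Sum-ε (allFin m) (λ k _ → no-term k)))
      where
      no-term : ∀ k → (if lookup M k then shiftI k else ℤ.+ 0) ≡ ℤ.+ 0
      no-term k with lookup M k in Mk
      ... | false = ≡.refl
      ... | true  = ⊥-elim (empty (k , Mk))
    ... | yes (k , Mk) = removal fuel small
      where
      v    = srcI k
      spec = cycleThrough-spec M mc v (selected-out M k Mk)
      sc   = proj₁ spec
      open Removal M v (cycleThrough M v) mc sc (proj₂ spec)
      removal : ∀ fuel → size M ≤ fuel → ℤ.+ 0 ℤ.≤ windM M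
      removal zero        small′ with ℕP.<-≤-trans size-decreases small′
      ... | ()
      removal (suc fuel′) small′ = begin
        ℤ.+ 0                                    ≤⟨ windM≥0′ fuel′ M′ (ℕP.≤-pred (ℕP.<-≤-trans size-decreases small′)) M′-multicycle ⟩
        windM M′                                 ≡⟨ ℤP.+-identityʳ (windM M′) ⟨
        windM M′ ℤ.+ ℤ.+ 0                       ≤⟨ ℤP.+-monoʳ-≤ (windM M′) (ℤP.<⇒≤ (cycle-shift-positive v _ sc)) ⟩
        windM M′ ℤ.+ walkShift (cycleThrough M v) ≡⟨ windM-split ⟨
        windM M                                  ∎
        where open ℤP.≤-Reasoning

    windM≥0 : ∀ M → IsMulticycle M → ℤ.+ 0 ℤ.≤ windM M
    windM≥0 M = windM≥0′ (size M) M ℕP.≤-refl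

  -- every edge shifts by at most smax, so a walk of length l by at most l·smax
  smax : ℕ
  smax = ℕΣ.Sum (λ k → ℤ.∣ shiftI k ∣) (allFin m)

  x≤∣x∣ : ∀ x → x ℤ.≤ ℤ.+ ℤ.∣ x ∣
  x≤∣x∣ (ℤ.+ k)     = ℤP.≤-refl
  x≤∣x∣ ℤ.-[1+ k ] = ℤ.-≤+

  walkShift≤ : ∀ ws → walkShift ws ℤ.≤ ℤ.+ (length ws * smax)
  walkShift≤ []       = ℤP.≤-refl
  walkShift≤ (k ∷ ws) =
    ℤP.≤-trans (ℤP.+-mono-≤ (ℤP.≤-trans (x≤∣x∣ (shiftI k)) (ℤ.+≤+ (term≤Sum (λ k → ℤ.∣ shiftI k ∣) k))) (walkShift≤ ws))
               (ℤP.≤-reflexive (≡.sym (ℤP.pos-+ smax (length ws * smax))))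

module Recurrence {c ℓ} (R : CommutativeRing c ℓ) (N : ℕ) (es : List (Edge N (CommutativeRing.Carrier R)))
  (acyclic : Net.Acyclic R N es) (a b : Fin N) (i j : ℤ) (F : ℕ → ℕ)
  (F-bounds : ∀ n (p : Net.Path R N es (a , i) (b , j ℤ.+ ℤ.+ n)) → Net.pathLength R N p ≤ F n) where

  open import Data.Bool using (Bool; true; false; if_then_else_; _∧_)
  open import Defs
  import Data.Bool as Bool
  open import Data.Nat as ℕ using (zero; suc; _+_; _<_)
  import Data.Nat.Properties as ℕP
  import Data.Integer.Properties as ℤP
  open import Data.Integer.Tactic.RingSolver using (solve-∀)
  open import Data.Fin.Properties using (_≟_)
  open import Data.List as L using (map; length; cartesianProduct)
  import Data.List.Properties as LP
  open import Data.List.Membership.Propositional using (_∈_)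
  open import Data.List.Membership.Propositional.Properties using (∈-cartesianProduct⁺)
  open import Data.List.Relation.Unary.Unique.Propositional using (Unique)
  import Data.List.Relation.Unary.Unique.Propositional.Properties as UniqueP
  open import Data.Vec using (Vec)
  import Data.Vec.Properties as VecP
  import Data.Product.Properties as ProductP
  open import Data.Product using (_×_; proj₁; proj₂)
  open import Data.Sum using (inj₁; inj₂)
  open import Relation.Nullary using (¬_; Dec)
  open import Relation.Nullary.Decidable using (⌊_⌋)
  open import Relation.Binary.PropositionalEquality as ≡ using (_≡_; _≢_)
  open import Function using (_∘_)
  open BoolFacts
  open Masks
  open NatSums using (unique-length)
  open IndexedEdges R N es
  open Walks R N es
  open MaskMulticycles R N es
  open CycleSwap R N es a
  open WindingBounds R N es

  open CommutativeRing R hiding (zero) renaming (_+_ to _+ᴿ_)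
  open Net R N
  open RingSums R
  open import Algebra.Properties.Ring ring using (-‿involutive; -‿distribˡ-*)
  import Relation.Binary.Reasoning.Setoid
  module ≈-Reasoning = Relation.Binary.Reasoning.Setoid setoid

  d : ℤ
  d = maxWind es

  D : ℕ
  D = ℤ.∣ d ∣

  f : ℕ → Carrier
  f n = pathSum es (F n) (a , i) (b , j ℤ.+ ℤ.+ n)

  sign : Vec Bool m → Carrier
  sign M = negOnePow R ℤ.∣ d ℤ.- ℤ.+ numCycles (select es M) ∣

  value : State → Carrier
  value (M , ws) = sign M * (wtM M * walkWeight ws)

  -- the coefficient of t^k in Q_N is Σ_S term k S over the r-cycles S
  term : ℕ → List E → Carrier
  term k S = if ⌊ ℤ.∣ d ℤ.- wind S ∣ ℕ.≟ k ⌋ then negOnePow R ℤ.∣ d ℤ.- ℤ.+ numCycles S ∣ * weight S else 0#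

  CycleMove-value : ∀ x y → CycleMove x y → value y ≈ - value x
  CycleMove-value (M , ws) (M′ , ws′) move = begin
    sign M′ * (wtM M′ * walkWeight ws′)                    ≈⟨ *-cong sign-flips (*-congʳ wtM≈) ⟩
    (- sign M) * ((wtM M * walkWeight cycle) * walkWeight ws′) ≈⟨ *-congˡ (*-assoc _ _ _) ⟩
    (- sign M) * (wtM M * (walkWeight cycle * walkWeight ws′)) ≈⟨ *-congˡ (*-congˡ (*-comm _ _)) ⟩
    (- sign M) * (wtM M * (walkWeight ws′ * walkWeight cycle)) ≈⟨ *-congˡ (*-congˡ (sym walkWeight≈)) ⟩
    (- sign M) * (wtM M * walkWeight ws)                   ≈⟨ -‿distribˡ-* _ _ ⟨
    - (sign M * (wtM M * walkWeight ws))                   ∎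
    where
    open ≈-Reasoning
    open CycleMove move
    sign-flips : sign M′ ≈ - sign M
    sign-flips rewrite numCycles≡ = negOnePow-suc d (numCycles (select es M))

  -- beyond n₀ every walk to the target height is too long to be simple
  n₀ : ℕ
  n₀ = suc (ℤ.∣ i ℤ.- j ∣ + N ℕ.* smax)

  long-walk-arith : ∀ (s e : ℤ) (n A : ℕ) → ℤ.+ 0 ℤ.≤ e → i ℤ.+ s ≡ j ℤ.+ (ℤ.+ n ℤ.+ e) → s ℤ.≤ ℤ.+ A →
                    n ≤ ℤ.∣ i ℤ.- j ∣ + A
  long-walk-arith s e n A 0≤e reach s≤A = ℤP.drop‿+≤+ (begin
    ℤ.+ n                          ≤⟨ ℤP.≤-trans (ℤP.≤-reflexive (≡.sym (ℤP.+-identityʳ (ℤ.+ n)))) (ℤP.+-monoʳ-≤ (ℤ.+ n) 0≤e) ⟩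
    ℤ.+ n ℤ.+ e                    ≡⟨ ≡.trans (≡.sym (cancel j (ℤ.+ n ℤ.+ e))) (≡.trans (≡.cong (ℤ._- j) (≡.sym reach)) (regroup i s j)) ⟩
    (i ℤ.- j) ℤ.+ s                ≤⟨ ℤP.+-mono-≤ (x≤∣x∣ (i ℤ.- j)) s≤A ⟩
    ℤ.+ ℤ.∣ i ℤ.- j ∣ ℤ.+ ℤ.+ A    ≡⟨ ℤP.pos-+ ℤ.∣ i ℤ.- j ∣ A ⟨
    ℤ.+ (ℤ.∣ i ℤ.- j ∣ + A)        ∎)
    where
    open ℤP.≤-Reasoning
    cancel : ∀ (j x : ℤ) → (j ℤ.+ x) ℤ.- j ≡ x
    cancel = solve-∀
    regroup : ∀ (i s j : ℤ) → (i ℤ.+ s) ℤ.- j ≡ (i ℤ.- j) ℤ.+ s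
    regroup = solve-∀

  -- Fsum q bounds the length of every path to a height j + q′ with q′ ≤ q
  Fsum : ℕ → ℕ
  Fsum zero    = F 0
  Fsum (suc q) = Fsum q + F (suc q)

  F≤Fsum : ∀ q q′ → q ≤ q′ → F q ≤ Fsum q′
  F≤Fsum zero zero _ = ℕP.≤-refl
  F≤Fsum q (suc q′) le with ℕP.m≤n⇒m<n∨m≡n le
  ... | inj₁ lt     = ℕP.≤-trans (F≤Fsum q q′ (ℕP.≤-pred lt)) (ℕP.m≤m+n _ _)
  ... | inj₂ ≡.refl = ℕP.m≤n+m _ _

  module AtLevel (n : ℕ) (n₀≤n : n₀ ≤ n) where

    -- all walks that matter have length ≤ K
    K : ℕ
    K = Fsum (n + D)

    target : Vec Bool m → ℤ
    target M = j ℤ.+ (ℤ.+ n ℤ.+ (d ℤ.- windM M))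

    gap : Vec Bool m → ℕ
    gap M = ℤ.∣ d ℤ.- windM M ∣

    module _ (M : Vec Bool m) (mc : IsMulticycle M) where

      0≤d-wind : ℤ.+ 0 ℤ.≤ d ℤ.- windM M
      0≤d-wind = ℤP.i≤j⇒0≤j-i (windM≤maxWind M mc)

      gap≡ : ℤ.+ gap M ≡ d ℤ.- windM M
      gap≡ = ℤP.0≤i⇒+∣i∣≡i 0≤d-wind

      target≡ : target M ≡ j ℤ.+ ℤ.+ (n + gap M)
      target≡ = ≡.cong (λ z → j ℤ.+ z) (≡.trans (≡.cong (λ z → ℤ.+ n ℤ.+ z) (≡.sym gap≡)) (≡.sym (ℤP.pos-+ n (gap M))))

      -- 0 ≤ wind M gives d - wind M ≤ d
      gap≤D : gap M ≤ D
      gap≤D = ℤP.drop‿+≤+ (ℤP.≤-trans (ℤP.≤-reflexive gap≡)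
                (ℤP.≤-trans (ℤP.≤-trans (ℤP.≤-reflexive (≡.sym (ℤP.+-identityʳ (d ℤ.- windM M))))
                                        (ℤP.+-monoʳ-≤ (d ℤ.- windM M) (windM≥0 acyclic M mc)))
                  (ℤP.≤-reflexive (≡.trans (cancel d (windM M)) (≡.sym (ℤP.0≤i⇒+∣i∣≡i 0≤maxWind))))))
        where
        cancel : ∀ (x y : ℤ) → (x ℤ.- y) ℤ.+ y ≡ x
        cancel = solve-∀

      f-as-walks : f (n + gap M) ≈ Sum (λ ws → walkValue ws (a , i) (b , target M)) (seqsUpTo K)
      f-as-walks = begin
        f (n + gap M)
          ≈⟨ sumUpTo-extend (F (n + gap M)) K (F≤Fsum (n + gap M) (n + D) (ℕP.+-monoʳ-≤ n gap≤D)) too-long ⟨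
        pathSum es K (a , i) (b , j ℤ.+ ℤ.+ (n + gap M))
          ≈⟨ pathSum≈Sum-walkValue K (a , i) (b , j ℤ.+ ℤ.+ (n + gap M)) ⟩
        Sum (λ ws → walkValue ws (a , i) (b , j ℤ.+ ℤ.+ (n + gap M))) (seqsUpTo K)
          ≡⟨ ≡.cong (λ z → Sum (λ ws → walkValue ws (a , i) (b , z)) (seqsUpTo K)) (≡.sym target≡) ⟩
        Sum (λ ws → walkValue ws (a , i) (b , target M)) (seqsUpTo K) ∎
        where
        open ≈-Reasoning
        too-long : ∀ k → F (n + gap M) < k → k ≤ K → W es k (a , i) (b , j ℤ.+ ℤ.+ (n + gap M)) ≈ 0#
        too-long k lt _ = W-vanish a i b (j ℤ.+ ℤ.+ (n + gap M)) (F (n + gap M)) (F-bounds (n + gap M)) k lt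

    G : State → Carrier
    G (M , ws) = if isMulticycleM M then sign M * (wtM M * walkValue ws (a , i) (b , target M)) else 0#

    valid : State → Bool
    valid (M , ws) = isMulticycleM M ∧ isWalkFromTo a i ws b (target M)

    mask-contribution : ∀ M → (if isMulticycleM M then sumUpTo R D (λ j′ → term j′ (select es M) * f (n + j′)) else 0#) ≈
                              Sum (λ ws → G (M , ws)) (seqsUpTo K)
    mask-contribution M with isMulticycleM M in ok
    ... | false = sym (Sum-ε (seqsUpTo K) (λ _ _ → refl))
    ... | true  = begin
      sumUpTo R D (λ j′ → term j′ (select es M) * f (n + j′))
        ≈⟨ sumUpTo-delta D (ℤ.∣ d ℤ.- wind (select es M) ∣) (sign M * weight (select es M)) (λ j′ → f (n + j′)) in-range ⟩
      (sign M * weight (select es M)) * f (n + ℤ.∣ d ℤ.- wind (select es M) ∣)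
        ≡⟨ ≡.cong (λ z → (sign M * weight (select es M)) * f (n + ℤ.∣ d ℤ.- z ∣)) (wind-select M) ⟩
      (sign M * weight (select es M)) * f (n + gap M)
        ≈⟨ *-cong (*-congˡ (weight-select M)) (f-as-walks M mc) ⟩
      (sign M * wtM M) * Sum (λ ws → walkValue ws (a , i) (b , target M)) (seqsUpTo K)
        ≈⟨ Sum-*ˡ _ _ (seqsUpTo K) ⟩
      Sum (λ ws → (sign M * wtM M) * walkValue ws (a , i) (b , target M)) (seqsUpTo K)
        ≈⟨ Sum-cong′ (seqsUpTo K) (λ ws → *-assoc _ _ _) ⟩
      Sum (λ ws → sign M * (wtM M * walkValue ws (a , i) (b , target M))) (seqsUpTo K) ∎
      where
      open ≈-Reasoning
      mc = isMulticycleM⁻ M ok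
      in-range : ℤ.∣ d ℤ.- wind (select es M) ∣ ≤ D
      in-range = ≡.subst (λ z → ℤ.∣ d ℤ.- z ∣ ≤ D) (≡.sym (wind-select M)) (gap≤D M mc)

    Valid : State → Set
    Valid (M , ws) = IsMulticycle M × IsWalk a ws × walkEnd a ws ≡ b × i ℤ.+ walkShift ws ≡ target M

    valid⇒Valid : ∀ x → valid x ≡ true → Valid x
    valid⇒Valid (M , ws) ok with ∧-true⁻ {isMulticycleM M} ok
    ... | mc , path with ∧-true⁻ {isWalk a ws} path
    ... | walk , ends with ∧-true⁻ {⌊ walkEnd a ws ≟ b ⌋} ends
    ... | end , reach = isMulticycleM⁻ M mc , isWalk⁻ a ws walk ,
                        true-witness (walkEnd a ws ≟ b) end , true-witness (i ℤ.+ walkShift ws ℤ.≟ target M) reach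

    Valid⇒valid : ∀ x → Valid x → valid x ≡ true
    Valid⇒valid (M , ws) (mc , walk , end , reach)
      rewrite isMulticycleM⁺ M mc | isWalk⁺ a ws walk | witness-true (walkEnd a ws ≟ b) end
            | witness-true (i ℤ.+ walkShift ws ℤ.≟ target M) reach = ≡.refl

    G-valid : ∀ x → valid x ≡ true → G x ≈ value x
    G-valid (M , ws) ok with isMulticycleM M | isWalkFromTo a i ws b (target M) in path
    ... | true | true = *-congˡ (*-congˡ (≡.subst (λ t → walkValue ws (a , i) (b , target M) ≈ (if t then walkWeight ws else 0#))
                                                   path (walkValue≈ ws a i b (target M))))

    G-invalid : ∀ x → valid x ≡ false → G x ≈ 0#
    G-invalid (M , ws) bad with isMulticycleM M
    ... | false = refl
    ... | true  = trans (*-congˡ (*-congˡ (≡.subst (λ t → walkValue ws (a , i) (b , target M) ≈ (if t then walkWeight ws else 0#))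
                                                    bad (walkValue≈ ws a i b (target M)))))
                        (trans (*-congˡ (zeroʳ _)) (zeroʳ _))

    -- a valid walk rises by at least n - |i - j| ≥ N·smax, so it has more
    -- than N edges and repeats a vertex
    not-simple : ∀ M ws → Valid (M , ws) → ¬ Unique (map srcI ws)
    not-simple M ws (mc , walk , end , reach) ws! = ℕP.<-irrefl ≡.refl (ℕP.≤-trans n₀≤n
      (long-walk-arith (walkShift ws) (d ℤ.- windM M) n (N ℕ.* smax) (0≤d-wind M mc) reach
        (ℤP.≤-trans (walkShift≤ ws) (ℤ.+≤+ (ℕP.*-monoˡ-≤ smax
          (≡.subst (_≤ N) (LP.length-map srcI ws) (unique-length (map srcI ws) ws!)))))))

    reach-moves : ∀ x y → CycleMove x y → i ℤ.+ walkShift (proj₂ x) ≡ target (proj₁ x) → i ℤ.+ walkShift (proj₂ y) ≡ target (proj₁ y)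
    reach-moves (M , ws) (M′ , ws′) move reach = begin
      i ℤ.+ walkShift ws′                                  ≡⟨ cancel i (walkShift ws′) s ⟩
      (i ℤ.+ (walkShift ws′ ℤ.+ s)) ℤ.- s                ≡⟨ ≡.cong (λ z → (i ℤ.+ z) ℤ.- s) (≡.sym walkShift≡) ⟩
      (i ℤ.+ walkShift ws) ℤ.- s                         ≡⟨ ≡.cong (ℤ._- s) reach ⟩
      target M ℤ.- s                                     ≡⟨ shift-target j (ℤ.+ n) d (windM M) s ⟩
      j ℤ.+ (ℤ.+ n ℤ.+ (d ℤ.- (windM M ℤ.+ s)))          ≡⟨ ≡.cong (λ z → j ℤ.+ (ℤ.+ n ℤ.+ (d ℤ.- z))) (≡.sym windM≡) ⟩
      target M′                                          ∎
      where
      open ≡.≡-Reasoning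
      open CycleMove move
      s = walkShift cycle
      cancel : ∀ (i w s : ℤ) → i ℤ.+ w ≡ (i ℤ.+ (w ℤ.+ s)) ℤ.- s
      cancel = solve-∀
      shift-target : ∀ (j n d w s : ℤ) → (j ℤ.+ (n ℤ.+ (d ℤ.- w))) ℤ.- s ≡ j ℤ.+ (n ℤ.+ (d ℤ.- (w ℤ.+ s)))
      shift-target = solve-∀

    reach-moves⁻ : ∀ x y → CycleMove x y → i ℤ.+ walkShift (proj₂ y) ≡ target (proj₁ y) → i ℤ.+ walkShift (proj₂ x) ≡ target (proj₁ x)
    reach-moves⁻ (M , ws) (M′ , ws′) move reach = begin
      i ℤ.+ walkShift ws                                   ≡⟨ ≡.cong (λ z → i ℤ.+ z) walkShift≡ ⟩
      i ℤ.+ (walkShift ws′ ℤ.+ s)                          ≡⟨ ℤP.+-assoc i (walkShift ws′) s ⟨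
      (i ℤ.+ walkShift ws′) ℤ.+ s                          ≡⟨ ≡.cong (ℤ._+ s) (≡.trans reach (≡.cong (λ z → j ℤ.+ (ℤ.+ n ℤ.+ (d ℤ.- z))) windM≡)) ⟩
      (j ℤ.+ (ℤ.+ n ℤ.+ (d ℤ.- (windM M ℤ.+ s)))) ℤ.+ s   ≡⟨ unshift-target j (ℤ.+ n) d (windM M) s ⟩
      target M                                            ∎
      where
      open ≡.≡-Reasoning
      open CycleMove move
      s = walkShift cycle
      unshift-target : ∀ (j n d w s : ℤ) → (j ℤ.+ (n ℤ.+ (d ℤ.- (w ℤ.+ s)))) ℤ.+ s ≡ j ℤ.+ (n ℤ.+ (d ℤ.- w))
      unshift-target = solve-∀

    ι-involution : ∀ x → valid x ≡ true → valid (ι x) ≡ true × ι (ι x) ≡ x × ι x ≢ x × G (ι x) ≈ - G x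
    ι-involution x@(M , ws) ok =
      Valid⇒valid (ι x) valid-y , ι-back , moved , trans (G-valid (ι x) (Valid⇒valid (ι x) valid-y)) (trans value-flips (-‿cong (sym (G-valid x ok))))
      where
      Vx = valid⇒Valid x ok
      mc = proj₁ Vx
      walk = proj₁ (proj₂ Vx)
      end = proj₁ (proj₂ (proj₂ Vx))
      reach = proj₂ (proj₂ (proj₂ Vx))
      swapped = ι-swaps M ws mc walk (not-simple M ws Vx)
      open Swapped swapped
      valid-y : Valid (ι x)
      valid-y with move
      ... | inj₁ x→y = multicycle , Swapped.walk swapped , ≡.trans same-end end , reach-moves x (ι x) x→y reach
      ... | inj₂ y→x = multicycle , Swapped.walk swapped , ≡.trans same-end end , reach-moves⁻ (ι x) x y→x reach
      value-flips : value (ι x) ≈ - value x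
      value-flips with move
      ... | inj₁ x→y = CycleMove-value x (ι x) x→y
      ... | inj₂ y→x = trans (sym (-‿involutive _)) (-‿cong (sym (CycleMove-value (ι x) x y→x)))

    domain : List State
    domain = cartesianProduct (masks m) (seqsUpTo K)

    domain-unique : Unique domain
    domain-unique = UniqueP.cartesianProduct⁺ (masks-unique m) (seqsUpTo-unique K)

    -- valid walks have length ≤ K, so ι stays in the domain
    valid-short : ∀ M ws → Valid (M , ws) → length ws ≤ K
    valid-short M ws (mc , walk , ≡.refl , reach) with walk⇒path a i ws walk
    ... | p , len = ℕP.≤-trans (ℕP.≤-reflexive (≡.sym (≡.trans (pathLength-subst (walkEnd a ws ,_) to-height p) len)))
                      (ℕP.≤-trans (F-bounds (n + gap M) (≡.subst (Path es (a , i) ∘ (walkEnd a ws ,_)) to-height p))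
                                  (F≤Fsum (n + gap M) (n + D) (ℕP.+-monoʳ-≤ n (gap≤D M mc))))
      where
      to-height : i ℤ.+ walkShift ws ≡ j ℤ.+ ℤ.+ (n + gap M)
      to-height = ≡.trans reach (target≡ M mc)

    domain-closed : ∀ x → x ∈ domain → valid x ≡ true → ι x ∈ domain
    domain-closed x _ ok = ∈-cartesianProduct⁺ (masks-complete m (proj₁ (ι x)))
      (seqsUpTo-complete K (proj₂ (ι x)) (valid-short (proj₁ (ι x)) (proj₂ (ι x)) (valid⇒Valid (ι x) (proj₁ (ι-involution x ok)))))

    _≟State_ : (x y : State) → Dec (x ≡ y)
    _≟State_ = ProductP.≡-dec (VecP.≡-dec Bool._≟_) (LP.≡-dec _≟_)

    open SignReversingInvolution +-abelianGroup _≟State_ using (Sum-vanishes)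

    cancellation : Sum G domain ≈ 0#
    cancellation = Sum-vanishes valid ι G ι-involution G-invalid domain domain-unique domain-closed

open import Defs
open import Level using (Level)
open import Data.Integer using (ℤ; _+_; +_)
open import Data.List using (List; map)
open import Data.List.Relation.Unary.Unique.Propositional using (Unique)
import Data.Nat as ℕ
open import Data.Bool using (if_then_else_)
import Relation.Binary.Reasoning.Setoid as SetoidReasoning
-- Theorem 2.1.  The recurrence holds from n₀ on: the recurrence sum is
-- rewritten as a sum over multicycle masks, then over states (M , ws),
-- where ι cancels it.

theorem2p1 : {c ℓ : Level} (R : CommutativeRing c ℓ) → IsField R → CharZero R →
  (n : ℕ) (es : List (Edge n (CommutativeRing.Carrier R))) →
  Unique (map edgeKey es) → Net.Acyclic R n es →
  (a b : Fin n) (i j : ℤ) →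
  (F : ℕ → ℕ) →
  (∀ m (p : Net.Path R n es (a , i) (b , j + + m)) → Net.pathLength R n p ≤ F m) →
  SatisfiesRecurrence R (λ m → Net.pathSum R n es (F m) (a , i) (b , j + + m))
    (Net.charPoly R n es)
theorem2p1 R _ _ N es _ acyclic a b i j F F-bounds = n₀ , recurrence
  where
  open CommutativeRing R using (_≈_; _*_; 0#)
  open Net R N using (multicycles)
  open Recurrence R N es acyclic a b i j F F-bounds
  open RingSums R
  open Masks using (masks; select)
  open IndexedEdges R N es using (m)
  open Walks R N es using (seqsUpTo)
  open WindingBounds R N es using (Sum-multicycles)
  open MaskMulticycles R N es using (isMulticycleM)
  recurrence : ∀ n → n₀ ≤ n → sumUpTo R D (λ k → Sum (term k) (multicycles es) * f (n ℕ.+ k)) ≈ 0#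
  recurrence n n₀≤n = begin
    sumUpTo R D (λ k → Sum (term k) (multicycles es) * f (n ℕ.+ k))
      ≈⟨ sumUpTo-cong D (λ k _ → Sum-*ʳ (f (n ℕ.+ k)) (term k) (multicycles es)) ⟩
    sumUpTo R D (λ k → Sum (λ S → term k S * f (n ℕ.+ k)) (multicycles es))
      ≈⟨ sumUpTo-Sum D (λ k S → term k S * f (n ℕ.+ k)) (multicycles es) ⟩
    Sum (λ S → sumUpTo R D (λ k → term k S * f (n ℕ.+ k))) (multicycles es)
      ≈⟨ Sum-multicycles (λ S → sumUpTo R D (λ k → term k S * f (n ℕ.+ k))) ⟩
    Sum (λ M → if isMulticycleM M then sumUpTo R D (λ k → term k (select es M) * f (n ℕ.+ k)) else 0#) (masks m)
      ≈⟨ Sum-cong′ (masks m) mask-contribution ⟩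
    Sum (λ M → Sum (λ ws → G (M , ws)) (seqsUpTo K)) (masks m)
      ≈⟨ Sum-cartesianProductWith G _,_ (masks m) (seqsUpTo K) ⟨
    Sum G domain
      ≈⟨ cancellation ⟩
    0# ∎
    where
    open AtLevel n n₀≤n
    open SetoidReasoning (CommutativeRing.setoid R)
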